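{- If $T$ is a tree which is not a path, then for every $r\in\{1,\dots,\varsigma(T)\}$, $$\dim_r(T)=\sum_{w\in\mathcal{M}(T)}I_r(w).$$
   Context: For a connected graph $G$ with shortest-path distance $d_G$: a set $S\subseteq V(G)$ is an $r$-metric generator if every pair of distinct vertices $x,y$ has at least $r$ elements $w\in S$ with $d_G(x,w)\ne d_G(y,w)$; $\dim_r(G)$ is the minimum cardinality of an $r$-metric generator. A major vertex has degree at least $3$. A degree-one vertex $u$ is a terminal vertex of a major vertex $v$ if $d_G(u,v)<d_G(u,w)$ for every other major vertex $w$; $\operatorname{ter}(v)$ is the number of terminal vertices of $v$; $\mathcal{M}(G)$ is the set of major vertices with $\operatorname{ter}(v)>1$. For $w\in\mathcal{M}(G)$: $l(w)$ is the minimum of $d_G(u,w)$ over terminal vertices $u$ of $w$; for distinct terminal vertices $u_j,u_r$ of $w$, $\varsigma(u_j,u_r)$ is the length of a shortest $u_j$–$u_r$ path containing $w$; $\varsigma(w)$ is the minimum of these over distinct pairs; $\varsigma(G)=\min_{w\in\mathcal{M}(G)}\varsigma(w)$. For an integer $r$, $I_r(w)=(\operatorname{ter}(w)-1)(r-l(w))+l(w)$ if $l(w)\le\lfloor r/2\rfloor$, and $I_r(w)=(\operatorname{ter}(w)-1)\lceil r/2\rceil+\lfloor r/2\rfloor$ otherwise. -}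

module Defs where

open import Data.Nat using (ℕ; zero; suc; _+_; _*_; _∸_; _≤_; _<_; _⊓_; _/_; _≤ᵇ_; _<ᵇ_; _≡ᵇ_)
open import Data.Bool using (Bool; true; false; _∧_; _∨_; not; if_then_else_; T)
open import Data.Fin using (Fin; toℕ)
open import Data.Fin.Properties using (_≟_)
open import Data.Fin.Subset using (Subset; ∣_∣)
open import Data.Fin.Subset.Properties using (_∈?_)
open import Data.List using (List; []; _∷_; _++_; length; map; filterᵇ; allFin; concatMap)
open import Data.Bool.ListAction using (any; all)
open import Data.List.Relation.Unary.Linked using (Linked)
open import Data.List.Relation.Unary.Unique.Propositional using (Unique)
open import Data.Product using (Σ; ∃; _×_)
open import Data.Sum using (_⊎_)
open import Function.Definitions using (Injective)
open import Function.Bundles using (_⇔_)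
open import Relation.Binary.PropositionalEquality using (_≡_; _≢_)
open import Relation.Nullary using (¬_)
open import Relation.Nullary.Decidable using (⌊_⌋)

record Graph (n : ℕ) : Set where
  field
    adj    : Fin n → Fin n → Bool
    sym    : ∀ x y → adj x y ≡ adj y x
    irrefl : ∀ x → adj x x ≡ false
open Graph public

Adj : ∀ {n} → Graph n → Fin n → Fin n → Set
Adj G x y = adj G x y ≡ true

reach : ∀ {n} → Graph n → ℕ → Fin n → Fin n → Bool
reach G zero    x y = ⌊ x ≟ y ⌋
reach {n} G (suc k) x y = reach G k x y ∨ any (λ z → adj G x z ∧ reach G k z y) (allFin n)

Connected : ∀ {n} → Graph n → Set
Connected G = ∀ x y → ∃ λ k → reach G k x y ≡ true

-- least k in {start, …, start + fuel - 1} with p k; (start + fuel) if none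
search : (ℕ → Bool) → ℕ → ℕ → ℕ
search p k zero       = k
search p k (suc fuel) = if p k then k else search p (suc k) fuel

-- shortest-path distance d_G(x,y): least k such that a walk of length ≤ k
-- from x to y exists (in a connected graph on n vertices this k is < n)
dist : ∀ {n} → Graph n → Fin n → Fin n → ℕ
dist {n} G x y = search (λ k → reach G k x y) 0 n

IsCycle : ∀ {n} → Graph n → List (Fin n) → Set
IsCycle G []       = Data.Empty.⊥ where import Data.Empty
IsCycle G (v ∷ vs) = (2 ≤ length vs) × Unique (v ∷ vs) × Linked (Adj G) (v ∷ vs ++ v ∷ [])

Acyclic : ∀ {n} → Graph n → Set
Acyclic G = ∀ cs → ¬ IsCycle G cs

IsTree : ∀ {n} → Graph n → Set
IsTree G = Connected G × Acyclic G

IsPathGraph : ∀ {n} → Graph n → Set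
IsPathGraph {n} G = Σ (Fin n → Fin n) λ f → Injective _≡_ _≡_ f ×
  (∀ x y → Adj G x y ⇔ (toℕ (f x) ≡ suc (toℕ (f y)) ⊎ toℕ (f y) ≡ suc (toℕ (f x))))

resolving : ∀ {n} → Graph n → Subset n → Fin n → Fin n → ℕ
resolving {n} G S x y =
  length (filterᵇ (λ w → ⌊ w ∈? S ⌋ ∧ not (dist G x w ≡ᵇ dist G y w)) (allFin n))

IsRMetricGenerator : ∀ {n} → ℕ → Graph n → Subset n → Set
IsRMetricGenerator r G S = ∀ x y → x ≢ y → r ≤ resolving G S x y

IsDimR : ∀ {n} → ℕ → Graph n → ℕ → Set
IsDimR r G k =
  (Σ _ λ S → IsRMetricGenerator r G S × ∣ S ∣ ≡ k) ×
  (∀ S → IsRMetricGenerator r G S → k ≤ ∣ S ∣)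

degree : ∀ {n} → Graph n → Fin n → ℕ
degree {n} G v = length (filterᵇ (adj G v) (allFin n))

isMajor : ∀ {n} → Graph n → Fin n → Bool
isMajor G v = 3 ≤ᵇ degree G v

isTerminal : ∀ {n} → Graph n → Fin n → Fin n → Bool
isTerminal {n} G u v =
  (degree G u ≡ᵇ 1) ∧ isMajor G v ∧
  all (λ w → not (isMajor G w) ∨ ⌊ w ≟ v ⌋ ∨ (dist G u v <ᵇ dist G u w)) (allFin n)

terminals : ∀ {n} → Graph n → Fin n → List (Fin n)
terminals {n} G v = filterᵇ (λ u → isTerminal G u v) (allFin n)

ter : ∀ {n} → Graph n → Fin n → ℕ
ter G v = length (terminals G v)

𝓜 : ∀ {n} → Graph n → List (Fin n)
𝓜 {n} G = filterᵇ (λ v → isMajor G v ∧ (1 <ᵇ ter G v)) (allFin n)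

-- minimum of a list of naturals (0 for the empty list; only used on
-- nonempty lists)
minList : List ℕ → ℕ
minList []       = 0
minList (x ∷ xs) = Data.List.foldr _⊓_ x xs where import Data.List

l : ∀ {n} → Graph n → Fin n → ℕ
l G w = minList (map (λ u → dist G u w) (terminals G w))

-- ς(u_j,u_r) for terminal vertices of w: length of a shortest u_j–u_r
-- walk through w, i.e. d(u_j,w) + d(w,u_r)
ςpair : ∀ {n} → Graph n → Fin n → Fin n → Fin n → ℕ
ςpair G w uj ur = dist G uj w + dist G w ur

ςv : ∀ {n} → Graph n → Fin n → ℕ
ςv G w = minList (concatMap (λ uj →
           map (λ ur → ςpair G w uj ur)
               (filterᵇ (λ ur → not ⌊ uj ≟ ur ⌋) (terminals G w)))
         (terminals G w))

ςG : ∀ {n} → Graph n → ℕ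
ςG G = minList (map (ςv G) (𝓜 G))

⌈_/2⌉ : ℕ → ℕ
⌈ r /2⌉ = (r + 1) / 2

I : ∀ {n} → Graph n → ℕ → Fin n → ℕ
I G r w =
  if l G w ≤ᵇ (r / 2)
  then (ter G w ∸ 1) * (r ∸ l G w) + l G w
  else (ter G w ∸ 1) * ⌈ r /2⌉ + r / 2

-- For every w ∈ 𝓜 choose, on each leg of w (the path from w to one of its terminal
-- vertices), the vertices nearest to w: min (l(w), ⌊r/2⌋) of them on the leg of a nearest terminal
-- vertex and r minus that many on every other leg; r ≤ ς(T) makes the legs long enough, and the
-- count is I_r(w). Any two legs of w then carry at least r chosen vertices. Two vertices at odd
-- distance are told apart by every vertex, as distances in a tree change parity along each edge.
-- At even distance, the branches at their midpoint towards them contain a pair of legs of some vertex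
-- of 𝓜 (the major vertex farthest out in a branch, or the midpoint itself), and every vertex of such
-- a branch is nearer to one of the two. The two neighbours of w on distinct legs are told apart only by vertices on those two
-- legs, so an r-metric generator has at least r vertices on any two legs of w, hence at least I_r(w)
-- on the legs of w; legs of distinct vertices are disjoint.

module Submission where

open import Data.Bool using (Bool; true; false; _∧_; _∨_; not; if_then_else_; _xor_; T; T?)
import Data.Bool.Properties as BoolP
open import Data.Bool.ListAction using (any; all)
open import Data.Empty using (⊥; ⊥-elim)
open import Data.Fin using (Fin; zero; suc; toℕ)
open import Data.Fin.Properties using (_≟_; pigeonhole; toℕ<n)
import Data.Fin.Properties as FinP
open import Data.Fin.Subset using (Subset; ∣_∣)
open import Data.Fin.Subset.Properties using (_∈?_)
open import Data.List using (List; []; _∷_; _++_; length; map; filterᵇ; tabulate; allFin; foldr)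
open import Data.List.Membership.Propositional using (_∈_; _∉_; find)
import Data.List.Membership.Propositional.Properties as MemP
open import Data.List.Membership.Propositional.Properties using (∈-allFin)
import Data.List.Relation.Unary.All as All
import Data.List.Relation.Unary.Any as Any
open import Data.List.Relation.Unary.Any using (here; there)
open import Data.List.Relation.Unary.AllPairs using ([]; _∷_)
open import Data.List.Relation.Unary.Linked using (Linked; [-]; _∷_)
open import Data.List.Relation.Unary.Unique.Propositional using (Unique)
import Data.List.Relation.Unary.Unique.Propositional.Properties as UP
open import Data.Nat hiding (_≟_)
open import Data.Nat.DivMod using (m/n≤m; m/n≡1+[m∸n]/n)
open import Data.Nat.Induction using (<-rec)
open import Data.Nat.ListAction using (sum)
open import Data.Nat.Properties hiding (_≟_)
open import Algebra.Properties.CommutativeSemigroup +-commutativeSemigroup using (interchange; x∙yz≈y∙xz)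
open import Data.Product using (Σ; _×_; _,_; proj₁; proj₂)
open import Data.Sum using (_⊎_; inj₁; inj₂; [_,_]′)
open import Data.Vec using (lookup)
import Data.Vec
open import Data.Vec.Properties using (lookup∘tabulate)
open import Function using (_∘_; id; case_of_)
open import Relation.Binary using (tri<; tri≈; tri>)
open import Relation.Binary.PropositionalEquality hiding ([_])
open import Relation.Nullary using (¬_; Dec; yes; no)
open import Relation.Nullary.Decidable using (⌊_⌋; _×-dec_; fromWitness; toWitness)
open import Defs hiding (sym; irrefl; ⌈_/2⌉)

∨-true⁺ˡ : ∀ {a b} → a ≡ true → (a ∨ b) ≡ true
∨-true⁺ˡ refl = refl

∨-true⁺ʳ : ∀ {a b} → b ≡ true → (a ∨ b) ≡ true
∨-true⁺ʳ {true}  _ = refl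
∨-true⁺ʳ {false} e = e

∨-true⁻ : ∀ {a b} → (a ∨ b) ≡ true → a ≡ true ⊎ b ≡ true
∨-true⁻ {true}  _ = inj₁ refl
∨-true⁻ {false} e = inj₂ e

∧-true⁺ : ∀ {a b} → a ≡ true → b ≡ true → (a ∧ b) ≡ true
∧-true⁺ refl e = e

∧-true⁻ˡ : ∀ {a b} → (a ∧ b) ≡ true → a ≡ true
∧-true⁻ˡ {true} _ = refl

∧-true⁻ʳ : ∀ {a b} → (a ∧ b) ≡ true → b ≡ true
∧-true⁻ʳ {true} e = e

not-true⁺ : ∀ {a} → a ≡ false → not a ≡ true
not-true⁺ refl = refl

not-true⁻ : ∀ {a} → not a ≡ true → a ≡ false
not-true⁻ {false} _ = refl

true≢false : ∀ {a} → a ≡ true → a ≡ false → ⊥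
true≢false refl ()

true⊎false : ∀ b → b ≡ true ⊎ b ≡ false
true⊎false true  = inj₁ refl
true⊎false false = inj₂ refl

T⇒≡true : ∀ {b} → T b → b ≡ true
T⇒≡true {true} _ = refl

≡true⇒T : ∀ {b} → b ≡ true → T b
≡true⇒T refl = _

if-true : ∀ {A : Set} {b} {x y : A} → b ≡ true → (if b then x else y) ≡ x
if-true refl = refl

if-false : ∀ {A : Set} {b} {x y : A} → b ≡ false → (if b then x else y) ≡ y
if-false refl = refl

⌊≟⌋-refl : ∀ {n} (x : Fin n) → ⌊ x ≟ x ⌋ ≡ true
⌊≟⌋-refl x = T⇒≡true (fromWitness {a? = x ≟ x} refl)

⌊≟⌋-true⁻ : ∀ {n} {x y : Fin n} → ⌊ x ≟ y ⌋ ≡ true → x ≡ y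
⌊≟⌋-true⁻ e = toWitness (≡true⇒T e)

⌊≟⌋-false⁺ : ∀ {n} {x y : Fin n} → x ≢ y → ⌊ x ≟ y ⌋ ≡ false
⌊≟⌋-false⁺ {x = x} {y} x≢y with x ≟ y
... | yes x≡y = ⊥-elim (x≢y x≡y)
... | no _    = refl

≤ᵇ-true⁺ : ∀ {m n} → m ≤ n → (m ≤ᵇ n) ≡ true
≤ᵇ-true⁺ m≤n = T⇒≡true (≤⇒≤ᵇ m≤n)

≤ᵇ-true⁻ : ∀ {m n} → (m ≤ᵇ n) ≡ true → m ≤ n
≤ᵇ-true⁻ e = ≤ᵇ⇒≤ _ _ (≡true⇒T e)

≤ᵇ-false⁻ : ∀ {m n} → (m ≤ᵇ n) ≡ false → n < m
≤ᵇ-false⁻ {m} {n} e with m ≤? n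
... | yes m≤n = ⊥-elim (true≢false (≤ᵇ-true⁺ m≤n) e)
... | no m≰n  = ≰⇒> m≰n

<ᵇ-true⁺ : ∀ {m n} → m < n → (m <ᵇ n) ≡ true
<ᵇ-true⁺ m<n = T⇒≡true (<⇒<ᵇ m<n)

<ᵇ-true⁻ : ∀ {m n} → (m <ᵇ n) ≡ true → m < n
<ᵇ-true⁻ e = <ᵇ⇒< _ _ (≡true⇒T e)

≡ᵇ-true⁺ : ∀ {m n} → m ≡ n → (m ≡ᵇ n) ≡ true
≡ᵇ-true⁺ {m} {n} m≡n = T⇒≡true (≡⇒≡ᵇ m n m≡n)

≡ᵇ-true⁻ : ∀ {m n} → (m ≡ᵇ n) ≡ true → m ≡ n
≡ᵇ-true⁻ e = ≡ᵇ⇒≡ _ _ (≡true⇒T e)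

≡ᵇ-false⁺ : ∀ {m n} → m ≢ n → (m ≡ᵇ n) ≡ false
≡ᵇ-false⁺ {m} {n} m≢n with m ≡ᵇ n in eq
... | true  = ⊥-elim (m≢n (≡ᵇ-true⁻ eq))
... | false = refl

any⁺ : ∀ {A : Set} (p : A → Bool) {xs : List A} {x} → x ∈ xs → p x ≡ true → any p xs ≡ true
any⁺ p (here refl) e = ∨-true⁺ˡ e
any⁺ p {y ∷ _} (there x∈xs) e = ∨-true⁺ʳ {p y} (any⁺ p x∈xs e)

any⁻ : ∀ {A : Set} (p : A → Bool) (xs : List A) → any p xs ≡ true → Σ A λ x → x ∈ xs × p x ≡ true
any⁻ p (y ∷ xs) e with ∨-true⁻ {p y} e
... | inj₁ py = y , here refl , py
... | inj₂ e′ = let (x , x∈xs , px) = any⁻ p xs e′ in x , there x∈xs , px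

all⁺ : ∀ {A : Set} (p : A → Bool) (xs : List A) → (∀ x → p x ≡ true) → all p xs ≡ true
all⁺ p []       h = refl
all⁺ p (x ∷ xs) h rewrite h x = all⁺ p xs h

all⁻ : ∀ {A : Set} (p : A → Bool) {xs : List A} → all p xs ≡ true → ∀ {x} → x ∈ xs → p x ≡ true
all⁻ p e (here refl) = ∧-true⁻ˡ e
all⁻ p {y ∷ _} e (there x∈xs) = all⁻ p (∧-true⁻ʳ {p y} e) x∈xs

𝟙 : Bool → ℕ
𝟙 true  = 1
𝟙 false = 0

count : ∀ {n} → (Fin n → Bool) → ℕ
count {zero}  p = 0
count {suc n} p = 𝟙 (p zero) + count (p ∘ suc)

length-filter-tabulate : ∀ {A : Set} {n} (p : A → Bool) (f : Fin n → A) →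
  length (filterᵇ p (tabulate f)) ≡ count (p ∘ f)
length-filter-tabulate {n = zero}  p f = refl
length-filter-tabulate {n = suc n} p f with p (f zero)
... | true  = cong suc (length-filter-tabulate p (f ∘ suc))
... | false = length-filter-tabulate p (f ∘ suc)

length-filter-allFin : ∀ {n} (p : Fin n → Bool) → length (filterᵇ p (allFin n)) ≡ count p
length-filter-allFin p = length-filter-tabulate p id

count-cong : ∀ {n} {p q : Fin n → Bool} → (∀ i → p i ≡ q i) → count p ≡ count q
count-cong {zero}  e = refl
count-cong {suc n} e = cong₂ _+_ (cong 𝟙 (e zero)) (count-cong (e ∘ suc))

𝟙-mono : ∀ {a b} → (a ≡ true → b ≡ true) → 𝟙 a ≤ 𝟙 b
𝟙-mono {false} h = z≤n
𝟙-mono {true}  h rewrite h refl = ≤-refl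

count-mono : ∀ {n} {p q : Fin n → Bool} → (∀ i → p i ≡ true → q i ≡ true) → count p ≤ count q
count-mono {zero}  h = z≤n
count-mono {suc n} h = +-mono-≤ (𝟙-mono (h zero)) (count-mono (h ∘ suc))

𝟙-∨ : ∀ a b → 𝟙 (a ∨ b) ≤ 𝟙 a + 𝟙 b
𝟙-∨ true  b = s≤s z≤n
𝟙-∨ false b = ≤-refl

count-∨ : ∀ {n} (p q : Fin n → Bool) → count (λ i → p i ∨ q i) ≤ count p + count q
count-∨ {zero}  p q = z≤n
count-∨ {suc n} p q = begin
  𝟙 (p zero ∨ q zero) + count (λ i → p (suc i) ∨ q (suc i))
    ≤⟨ +-mono-≤ (𝟙-∨ (p zero) (q zero)) (count-∨ (p ∘ suc) (q ∘ suc)) ⟩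
  (𝟙 (p zero) + 𝟙 (q zero)) + (count (p ∘ suc) + count (q ∘ suc))
    ≡⟨ interchange (𝟙 (p zero)) (𝟙 (q zero)) _ _ ⟩
  count p + count q ∎
  where open ≤-Reasoning

𝟙-∨-disjoint : ∀ a b → (a ≡ true → b ≡ true → ⊥) → 𝟙 (a ∨ b) ≡ 𝟙 a + 𝟙 b
𝟙-∨-disjoint true  true  h = ⊥-elim (h refl refl)
𝟙-∨-disjoint true  false h = refl
𝟙-∨-disjoint false b     h = refl

count-∨-disjoint : ∀ {n} (p q : Fin n → Bool) → (∀ i → p i ≡ true → q i ≡ true → ⊥) →
  count (λ i → p i ∨ q i) ≡ count p + count q
count-∨-disjoint {zero}  p q h = refl
count-∨-disjoint {suc n} p q h = begin
  𝟙 (p zero ∨ q zero) + count (λ i → p (suc i) ∨ q (suc i))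
    ≡⟨ cong₂ _+_ (𝟙-∨-disjoint (p zero) (q zero) (h zero)) (count-∨-disjoint (p ∘ suc) (q ∘ suc) (h ∘ suc)) ⟩
  (𝟙 (p zero) + 𝟙 (q zero)) + (count (p ∘ suc) + count (q ∘ suc))
    ≡⟨ interchange (𝟙 (p zero)) (𝟙 (q zero)) _ _ ⟩
  count p + count q ∎
  where open ≡-Reasoning

count-none : ∀ {n} (p : Fin n → Bool) → (∀ i → p i ≡ false) → count p ≡ 0
count-none {zero}  p h = refl
count-none {suc n} p h rewrite h zero = count-none (p ∘ suc) (h ∘ suc)

count≡1 : ∀ {n} (p : Fin n → Bool) {a} → p a ≡ true → (∀ i → p i ≡ true → i ≡ a) → count p ≡ 1
count≡1 p {zero} pa only rewrite pa = cong suc (count-none (p ∘ suc) not-suc)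
  where
  not-suc : ∀ i → p (suc i) ≡ false
  not-suc i with true⊎false (p (suc i))
  ... | inj₁ e = case only (suc i) e of λ ()
  ... | inj₂ e = e
count≡1 p {suc a} pa only with true⊎false (p zero)
... | inj₁ e = case only zero e of λ ()
... | inj₂ e rewrite e = count≡1 (p ∘ suc) pa (λ i e′ → FinP.suc-injective (only (suc i) e′))

-- not by recursion on a: ⌊ suc i ≟ suc a ⌋ is stuck rather than reducing to ⌊ i ≟ a ⌋, as ⌊_⌋ matches on
-- the Dec record produced by map′
count-≟ : ∀ {n} (a : Fin n) → count (λ i → ⌊ i ≟ a ⌋) ≡ 1
count-≟ a = count≡1 _ (⌊≟⌋-refl a) (λ i → ⌊≟⌋-true⁻)

_∈ᵇ_ : ∀ {n} → Fin n → List (Fin n) → Bool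
i ∈ᵇ xs = any (λ x → ⌊ i ≟ x ⌋) xs

∈ᵇ⁺ : ∀ {n} {i : Fin n} {xs} → i ∈ xs → (i ∈ᵇ xs) ≡ true
∈ᵇ⁺ {i = i} i∈xs = any⁺ (λ x → ⌊ i ≟ x ⌋) i∈xs (⌊≟⌋-refl i)

∈ᵇ⁻ : ∀ {n} {i : Fin n} xs → (i ∈ᵇ xs) ≡ true → i ∈ xs
∈ᵇ⁻ (x ∷ xs) e = [ here ∘ ⌊≟⌋-true⁻ , there ∘ ∈ᵇ⁻ xs ]′ (∨-true⁻ e)

count-∈ᵇ-≤ : ∀ {n} (xs : List (Fin n)) → count (_∈ᵇ xs) ≤ length xs
count-∈ᵇ-≤ {n} []   = ≤-reflexive (count-none {n} _ (λ _ → refl))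
count-∈ᵇ-≤ (x ∷ xs) = ≤-trans (count-∨ _ (_∈ᵇ xs)) (+-mono-≤ (≤-reflexive (count-≟ x)) (count-∈ᵇ-≤ xs))

count-∈ᵇ : ∀ {n} (xs : List (Fin n)) → Unique xs → count (_∈ᵇ xs) ≡ length xs
count-∈ᵇ {n} []   _          = count-none {n} _ (λ _ → refl)
count-∈ᵇ (x ∷ xs) (x∉ ∷ uniq) =
  trans (count-∨-disjoint _ (_∈ᵇ xs) apart) (cong₂ _+_ (count-≟ x) (count-∈ᵇ xs uniq))
  where
  apart : ∀ i → ⌊ i ≟ x ⌋ ≡ true → (i ∈ᵇ xs) ≡ true → ⊥
  apart i i≡x i∈xs = All.lookup x∉ (∈ᵇ⁻ xs i∈xs) (sym (⌊≟⌋-true⁻ i≡x))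

count≤length : ∀ {n} {p : Fin n → Bool} (xs : List (Fin n)) → (∀ i → p i ≡ true → i ∈ xs) → count p ≤ length xs
count≤length xs h = ≤-trans (count-mono (λ i e → ∈ᵇ⁺ (h i e))) (count-∈ᵇ-≤ xs)

length≤count : ∀ {n} {p : Fin n → Bool} (xs : List (Fin n)) → Unique xs → (∀ i → i ∈ xs → p i ≡ true) → length xs ≤ count p
length≤count xs uniq h = subst (_≤ _) (count-∈ᵇ xs uniq) (count-mono (λ i e → h i (∈ᵇ⁻ xs e)))

∃-∉ : ∀ {n} (p : Fin n → Bool) (xs : List (Fin n)) → length xs < count p → Σ (Fin n) λ i → p i ≡ true × i ∉ xs
∃-∉ p xs lt with FinP.any? (λ i → (p i BoolP.≟ true) ×-dec ((i ∈ᵇ xs) BoolP.≟ false))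
... | yes (i , pi , i∉xs) = i , pi , λ i∈xs → true≢false (∈ᵇ⁺ i∈xs) i∉xs
... | no ∄ = ⊥-elim (<⇒≱ lt (count≤length xs inside))
  where
  inside : ∀ i → p i ≡ true → i ∈ xs
  inside i pi with true⊎false (i ∈ᵇ xs)
  ... | inj₁ i∈xs = ∈ᵇ⁻ xs i∈xs
  ... | inj₂ i∉xs = ⊥-elim (∄ (i , pi , i∉xs))

unique₂ : ∀ {n} {a b : Fin n} → a ≢ b → Unique (a ∷ b ∷ [])
unique₂ a≢b = (a≢b All.∷ All.[]) ∷ All.[] ∷ []

unique₃ : ∀ {n} {a b c : Fin n} → a ≢ b → a ≢ c → b ≢ c → Unique (a ∷ b ∷ c ∷ [])
unique₃ a≢b a≢c b≢c = (a≢b All.∷ a≢c All.∷ All.[]) ∷ (b≢c All.∷ All.[]) ∷ All.[] ∷ []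

count≥2 : ∀ {n} (p : Fin n → Bool) {a b} → p a ≡ true → p b ≡ true → a ≢ b → 2 ≤ count p
count≥2 p pa pb a≢b = length≤count (_ ∷ _ ∷ []) (unique₂ a≢b) λ { _ (here refl) → pa ; _ (there (here refl)) → pb }

count≥3 : ∀ {n} (p : Fin n → Bool) {a b c} → p a ≡ true → p b ≡ true → p c ≡ true → a ≢ b → a ≢ c → b ≢ c → 3 ≤ count p
count≥3 p pa pb pc a≢b a≢c b≢c = length≤count (_ ∷ _ ∷ _ ∷ []) (unique₃ a≢b a≢c b≢c)
  λ { _ (here refl) → pa ; _ (there (here refl)) → pb ; _ (there (there (here refl))) → pc }

count-↔ : ∀ {n} {p q : Fin n → Bool} → (∀ i → p i ≡ true → q i ≡ true) → (∀ i → q i ≡ true → p i ≡ true) → count p ≡ count q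
count-↔ p⇒q q⇒p = ≤-antisym (count-mono p⇒q) (count-mono q⇒p)

anyOf : ∀ {A : Set} {n} → List A → (A → Fin n → Bool) → Fin n → Bool
anyOf []       P i = false
anyOf (x ∷ xs) P i = P x i ∨ anyOf xs P i

anyOf⁺ : ∀ {A : Set} {n} (xs : List A) (P : A → Fin n → Bool) {i x} → x ∈ xs → P x i ≡ true → anyOf xs P i ≡ true
anyOf⁺ (y ∷ xs) P (here refl)  e = ∨-true⁺ˡ e
anyOf⁺ (y ∷ xs) P (there x∈xs) e = ∨-true⁺ʳ (anyOf⁺ xs P x∈xs e)

anyOf⁻ : ∀ {A : Set} {n} (xs : List A) (P : A → Fin n → Bool) {i} → anyOf xs P i ≡ true → Σ A λ x → x ∈ xs × P x i ≡ true
anyOf⁻ (x ∷ xs) P {i} e with ∨-true⁻ {P x i} e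
... | inj₁ e₁ = x , here refl , e₁
... | inj₂ e₂ = let (y , y∈xs , e₃) = anyOf⁻ xs P e₂ in y , there y∈xs , e₃

count-anyOf-disjoint : ∀ {A : Set} {n} (xs : List A) (P : A → Fin n → Bool) → Unique xs →
  (∀ {x y i} → x ∈ xs → y ∈ xs → x ≢ y → P x i ≡ true → P y i ≡ true → ⊥) →
  count (anyOf xs P) ≡ sum (map (count ∘ P) xs)
count-anyOf-disjoint {n = n} [] P _ h = count-none {n} _ (λ _ → refl)
count-anyOf-disjoint (x ∷ xs) P (x∉ ∷ uniq) h =
  trans (count-∨-disjoint (P x) (anyOf xs P) apart)
        (cong (count (P x) +_) (count-anyOf-disjoint xs P uniq (λ x∈ y∈ → h (there x∈) (there y∈))))
  where
  apart : ∀ i → P x i ≡ true → anyOf xs P i ≡ true → ⊥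
  apart i e₁ e₂ with anyOf⁻ xs P e₂
  ... | y , y∈xs , e₃ = h (here refl) (there y∈xs) (All.lookup x∉ y∈xs) e₁ e₃

search-sound : ∀ (p : ℕ → Bool) k fuel j → j < fuel → p (k + j) ≡ true →
  search p k fuel ≤ k + j × p (search p k fuel) ≡ true
search-sound p k (suc fuel) j j<f e with p k in pk
... | true = m≤m+n k j , pk
... | false with j
...   | zero = ⊥-elim (true≢false (subst (λ t → p t ≡ true) (+-identityʳ k) e) pk)
...   | suc j′ with search-sound p (suc k) fuel j′ (≤-pred j<f) (subst (λ t → p t ≡ true) (+-suc k j′) e)
...     | le , e′ = ≤-trans le (≤-reflexive (sym (+-suc k j′))) , e′

⌊∈?⌋≡lookup : ∀ {n} (z : Fin n) (S : Subset n) → ⌊ z ∈? S ⌋ ≡ lookup S z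
⌊∈?⌋≡lookup zero    (true  Data.Vec.∷ S) = refl
⌊∈?⌋≡lookup zero    (false Data.Vec.∷ S) = refl
⌊∈?⌋≡lookup (suc z) (_     Data.Vec.∷ S) with z ∈? S | ⌊∈?⌋≡lookup z S
... | yes _ | e = e
... | no _  | e = e

∣∣≡count-∈? : ∀ {n} (S : Subset n) → ∣ S ∣ ≡ count (λ z → ⌊ z ∈? S ⌋)
∣∣≡count-∈? S = trans (∣∣≡count-lookup S) (count-cong (λ z → sym (⌊∈?⌋≡lookup z S)))
  where
  ∣∣≡count-lookup : ∀ {n} (S : Subset n) → ∣ S ∣ ≡ count (lookup S)
  ∣∣≡count-lookup Data.Vec.[]            = refl
  ∣∣≡count-lookup (true  Data.Vec.∷ S) = cong suc (∣∣≡count-lookup S)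
  ∣∣≡count-lookup (false Data.Vec.∷ S) = ∣∣≡count-lookup S

∈?-tabulate : ∀ {n} (p : Fin n → Bool) z → ⌊ z ∈? Data.Vec.tabulate p ⌋ ≡ p z
∈?-tabulate p z = trans (⌊∈?⌋≡lookup z (Data.Vec.tabulate p)) (lookup∘tabulate p z)

nonempty : ∀ {A : Set} {f : A → ℕ} {r} (xs : List A) → 1 ≤ r → r ≤ minList (map f xs) → Σ A (_∈ xs)
nonempty []       1≤r r≤0 = ⊥-elim (<⇒≱ 1≤r r≤0)
nonempty (x ∷ xs) _   _   = x , here refl

/2≡⌊/2⌋ : ∀ r → r / 2 ≡ ⌊ r /2⌋
/2≡⌊/2⌋ zero          = refl
/2≡⌊/2⌋ (suc zero)    = refl
/2≡⌊/2⌋ (suc (suc r)) = trans (m/n≡1+[m∸n]/n {suc (suc r)} {2} (s≤s (s≤s z≤n))) (cong suc (/2≡⌊/2⌋ r))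

∸⌊/2⌋≡⌈/2⌉ : ∀ r → r ∸ ⌊ r /2⌋ ≡ ⌈ r /2⌉
∸⌊/2⌋≡⌈/2⌉ r = trans (cong (_∸ ⌊ r /2⌋) (sym (⌊n/2⌋+⌈n/2⌉≡n r))) (m+n∸m≡n ⌊ r /2⌋ ⌈ r /2⌉)

⌈n/2⌉≤1+⌊n/2⌋ : ∀ r → ⌈ r /2⌉ ≤ suc ⌊ r /2⌋
⌈n/2⌉≤1+⌊n/2⌋ zero          = z≤n
⌈n/2⌉≤1+⌊n/2⌋ (suc zero)    = s≤s z≤n
⌈n/2⌉≤1+⌊n/2⌋ (suc (suc r)) = s≤s (⌈n/2⌉≤1+⌊n/2⌋ r)

r/2≤r∸r/2 : ∀ r → r / 2 ≤ r ∸ r / 2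
r/2≤r∸r/2 r rewrite /2≡⌊/2⌋ r | ∸⌊/2⌋≡⌈/2⌉ r = ⌊n/2⌋≤⌈n/2⌉ r

r∸r/2≤1+r/2 : ∀ r → r ∸ r / 2 ≤ suc (r / 2)
r∸r/2≤1+r/2 r rewrite /2≡⌊/2⌋ r | ∸⌊/2⌋≡⌈/2⌉ r = ⌈n/2⌉≤1+⌊n/2⌋ r

[r+1]/2≡r∸r/2 : ∀ r → (r + 1) / 2 ≡ r ∸ r / 2
[r+1]/2≡r∸r/2 r = begin
  (r + 1) / 2     ≡⟨ cong (_/ 2) (+-comm r 1) ⟩
  suc r / 2       ≡⟨ /2≡⌊/2⌋ (suc r) ⟩
  ⌈ r /2⌉         ≡⟨ ∸⌊/2⌋≡⌈/2⌉ r ⟨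
  r ∸ ⌊ r /2⌋     ≡⟨ cong (r ∸_) (/2≡⌊/2⌋ r) ⟨
  r ∸ r / 2       ∎
  where open ≡-Reasoning

odd : ℕ → Bool
odd zero    = false
odd (suc k) = not (odd k)

even⇒double : ∀ k → odd k ≡ false → Σ ℕ λ h → k ≡ h + h
even⇒double zero          _ = 0 , refl
even⇒double (suc zero)    ()
even⇒double (suc (suc k)) e with even⇒double k (trans (sym (BoolP.not-involutive (odd k))) e)
... | h , k≡h+h = suc h , trans (cong (λ t → suc (suc t)) k≡h+h) (cong suc (sym (+-suc h h)))

minimal-witness : (P : ℕ → Set) → (∀ i → Dec (P i)) → ∀ N → P N →
  Σ ℕ λ i → i ≤ N × P i × (∀ i′ → i′ < i → ¬ P i′)
minimal-witness P P? N pN = go N 0 (+-identityʳ N) (λ _ ())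
  where
  go : ∀ m k → m + k ≡ N → (∀ i′ → i′ < k → ¬ P i′) → Σ ℕ λ i → i ≤ N × P i × (∀ i′ → i′ < i → ¬ P i′)
  go m k m+k≡N below with P? k
  ... | yes pk = k , subst (k ≤_) m+k≡N (m≤n+m k m) , pk , below
  go zero    k m+k≡N below | no ¬pk = ⊥-elim (¬pk (subst P (sym m+k≡N) pN))
  go (suc m) k m+k≡N below | no ¬pk = go m (suc k) (trans (+-suc m k) m+k≡N) below′
    where
    below′ : ∀ i′ → i′ < suc k → ¬ P i′
    below′ i′ i′<1+k with m≤n⇒m<n∨m≡n (≤-pred i′<1+k)
    ... | inj₁ i′<k  = below i′ i′<k
    ... | inj₂ refl = ¬pk

∃≤? : (Q : ℕ → Set) → (∀ j → Dec (Q j)) → ∀ B → Dec (Σ ℕ λ j → j ≤ B × Q j)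
∃≤? Q Q? zero with Q? 0
... | yes q = yes (0 , z≤n , q)
... | no ¬q = no λ { (.0 , z≤n , q) → ¬q q }
∃≤? Q Q? (suc B) with Q? (suc B) | ∃≤? Q Q? B
... | yes q  | _                 = yes (suc B , ≤-refl , q)
... | no _   | yes (j , j≤B , q) = yes (j , m≤n⇒m≤1+n j≤B , q)
... | no ¬q  | no ¬below         = no λ { (j , j≤1+B , q) → [ (λ j<1+B → ¬below (j , ≤-pred j<1+B , q)) , (λ { refl → ¬q q }) ]′ (m≤n⇒m<n∨m≡n j≤1+B) }

segment : ∀ {n} → (ℕ → Fin n) → ℕ → ℕ → List (Fin n)
segment F k zero    = []
segment F k (suc m) = F k ∷ segment F (suc k) m

length-segment : ∀ {n} (F : ℕ → Fin n) k m → length (segment F k m) ≡ m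
length-segment F k zero    = refl
length-segment F k (suc m) = cong suc (length-segment F (suc k) m)

∈-segment⁻ : ∀ {n} (F : ℕ → Fin n) k m {x} → x ∈ segment F k m → Σ ℕ λ t → k ≤ t × t < k + m × x ≡ F t
∈-segment⁻ F k (suc m) (here refl) = k , ≤-refl , m<m+n k z<s , refl
∈-segment⁻ F k (suc m) (there x∈) with ∈-segment⁻ F (suc k) m x∈
... | t , k<t , t<k+1+m , x≡Ft = t , <⇒≤ k<t , subst (t <_) (sym (+-suc k m)) t<k+1+m , x≡Ft

segment-unique : ∀ {n} (F : ℕ → Fin n) k m → (∀ s t → k ≤ s → s < t → t < k + m → F s ≢ F t) →
  Unique (segment F k m)
segment-unique F k zero    h = []
segment-unique F k (suc m) h = All.tabulate head-fresh ∷ segment-unique F (suc k) m h′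
  where
  head-fresh : ∀ {x} → x ∈ segment F (suc k) m → F k ≢ x
  head-fresh x∈ with ∈-segment⁻ F (suc k) m x∈
  ... | t , k<t , t<k+1+m , refl = h k t ≤-refl k<t (subst (t <_) (sym (+-suc k m)) t<k+1+m)
  h′ : ∀ s t → suc k ≤ s → s < t → t < suc k + m → F s ≢ F t
  h′ s t k<s s<t t<k+1+m = h s t (<⇒≤ k<s) s<t (subst (t <_) (sym (+-suc k m)) t<k+1+m)

segment-linked : ∀ {n} (R : Fin n → Fin n → Set) (F : ℕ → Fin n) k m z →
  (∀ t → k ≤ t → t < k + m → R (F t) (F (suc t))) → R (F (k + m)) z →
  Linked R (segment F k (suc m) ++ z ∷ [])
segment-linked R F k zero    z h last = subst (λ t → R (F t) z) (+-identityʳ k) last ∷ [-]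
segment-linked R F k (suc m) z h last =
  h k ≤-refl (m<m+n k z<s) ∷ segment-linked R F (suc k) m z
    (λ t k<t t<k+1+m → h t (<⇒≤ k<t) (subst (t <_) (sym (+-suc k m)) t<k+1+m))
    (subst (λ t → R (F t) z) (+-suc k m) last)

argmax : ∀ {n} (P : Fin n → Bool) (f : Fin n → ℕ) (a : Fin n) → P a ≡ true →
  Σ (Fin n) λ z → P z ≡ true × (∀ z′ → P z′ ≡ true → f z′ ≤ f z)
argmax {n} P f a pa = let (z , pz , _ , max) = go (allFin n) a pa in z , pz , λ z′ → max (∈-allFin z′)
  where
  go : ∀ xs cur → P cur ≡ true →
    Σ (Fin n) λ z → P z ≡ true × f cur ≤ f z × (∀ {z′} → z′ ∈ xs → P z′ ≡ true → f z′ ≤ f z)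
  go [] cur pc = cur , pc , ≤-refl , λ ()
  go (x ∷ xs) cur pc with true⊎false (P x) | f cur ≤? f x
  ... | inj₁ px | yes cur≤x = let (z , pz , x≤z , max) = go xs x px in
    z , pz , ≤-trans cur≤x x≤z , λ { (here refl) _ → x≤z ; (there z′∈) → max z′∈ }
  ... | inj₁ px | no cur≰x = let (z , pz , cur≤z , max) = go xs cur pc in
    z , pz , cur≤z , λ { (here refl) _ → ≤-trans (<⇒≤ (≰⇒> cur≰x)) cur≤z ; (there z′∈) → max z′∈ }
  ... | inj₂ px | _ = let (z , pz , cur≤z , max) = go xs cur pc in
    z , pz , cur≤z , λ { (here refl) e → ⊥-elim (true≢false e px) ; (there z′∈) → max z′∈ }

minList-≤ : ∀ {xs x} → x ∈ xs → minList xs ≤ x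
minList-≤ {y ∷ ys} (here refl) = foldr-⊓-≤-init ys
  where
  foldr-⊓-≤-init : ∀ zs → foldr _⊓_ y zs ≤ y
  foldr-⊓-≤-init []       = ≤-refl
  foldr-⊓-≤-init (z ∷ zs) = ≤-trans (m⊓n≤n z _) (foldr-⊓-≤-init zs)
minList-≤ {y ∷ ys} (there x∈) = foldr-⊓-≤-∈ ys x∈
  where
  foldr-⊓-≤-∈ : ∀ zs {x} → x ∈ zs → foldr _⊓_ y zs ≤ x
  foldr-⊓-≤-∈ (z ∷ zs) (here refl) = m⊓n≤m z _
  foldr-⊓-≤-∈ (z ∷ zs) (there x∈) = ≤-trans (m⊓n≤n z _) (foldr-⊓-≤-∈ zs x∈)

argmin : ∀ {A : Set} → (A → ℕ) → A → List A → A
argmin f x []       = x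
argmin f x (y ∷ ys) = if f y ≤ᵇ f (argmin f x ys) then y else argmin f x ys

argmin-∈ : ∀ {A : Set} (f : A → ℕ) x ys → argmin f x ys ∈ x ∷ ys
argmin-∈ f x []       = here refl
argmin-∈ f x (y ∷ ys) with f y ≤ᵇ f (argmin f x ys)
... | true  = there (here refl)
... | false with argmin-∈ f x ys
...   | here e    = here e
...   | there y∈ = there (there y∈)

argmin-minList : ∀ {A : Set} (f : A → ℕ) x ys → f (argmin f x ys) ≡ minList (map f (x ∷ ys))
argmin-minList f x []       = refl
argmin-minList f x (y ∷ ys) with f y ≤? f (argmin f x ys)
... | yes fy≤ rewrite ≤ᵇ-true⁺ fy≤ = trans (sym (m≤n⇒m⊓n≡m fy≤)) (cong (f y ⊓_) (argmin-minList f x ys))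
... | no fy≰ with f y ≤ᵇ f (argmin f x ys) in eq
...   | true  = ⊥-elim (fy≰ (≤ᵇ-true⁻ eq))
...   | false = trans (sym (m≥n⇒m⊓n≡n (<⇒≤ (≰⇒> fy≰)))) (cong (f y ⊓_) (argmin-minList f x ys))

sum-map-cong : ∀ {A : Set} (xs : List A) {f g : A → ℕ} → (∀ {x} → x ∈ xs → f x ≡ g x) → sum (map f xs) ≡ sum (map g xs)
sum-map-cong []       h = refl
sum-map-cong (x ∷ xs) h = cong₂ _+_ (h (here refl)) (sum-map-cong xs (h ∘ there))

sum-map-mono : ∀ {A : Set} (xs : List A) {f g : A → ℕ} → (∀ {x} → x ∈ xs → f x ≤ g x) → sum (map f xs) ≤ sum (map g xs)
sum-map-mono []       h = z≤n
sum-map-mono (x ∷ xs) h = +-mono-≤ (h (here refl)) (sum-map-mono xs (h ∘ there))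

sum-map-const : ∀ {A : Set} (xs : List A) b → sum (map (λ _ → b) xs) ≡ length xs * b
sum-map-const []       b = refl
sum-map-const (x ∷ xs) b = cong (b +_) (sum-map-const xs b)

sum-map-≥-except : ∀ {A : Set} (xs : List A) (f : A → ℕ) {v} m → Unique xs → v ∈ xs →
  (∀ {u} → u ∈ xs → u ≢ v → m ≤ f u) → f v + (length xs ∸ 1) * m ≤ sum (map f xs)
sum-map-≥-except (x ∷ xs) f m (x∉ ∷ _) (here refl) h = +-monoʳ-≤ (f x) (begin
  length xs * m           ≡⟨ sum-map-const xs m ⟨
  sum (map (λ _ → m) xs)  ≤⟨ sum-map-mono xs (λ u∈ → h (there u∈) (λ { refl → All.lookup x∉ u∈ refl })) ⟩
  sum (map f xs)          ∎)
  where open ≤-Reasoning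
sum-map-≥-except (x ∷ y ∷ ys) f {v} m (x∉ ∷ uniq) (there v∈) h = begin
  f v + (m + length ys * m)  ≡⟨ x∙yz≈y∙xz (f v) m _ ⟩
  m + (f v + length ys * m)  ≤⟨ +-mono-≤ (h (here refl) (λ { refl → All.lookup x∉ v∈ refl })) (sum-map-≥-except (y ∷ ys) f m uniq v∈ (h ∘ there)) ⟩
  f x + sum (map f (y ∷ ys)) ∎
  where open ≤-Reasoning

sum-map-if-≟ : ∀ {n} (xs : List (Fin n)) {u₀ : Fin n} a b → Unique xs → u₀ ∈ xs →
  sum (map (λ u → if ⌊ u ≟ u₀ ⌋ then a else b) xs) ≡ a + (length xs ∸ 1) * b
sum-map-if-≟ (x ∷ xs) a b (x∉ ∷ _) (here refl) = cong₂ _+_ (if-true (⌊≟⌋-refl x)) (begin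
  sum (map (λ u → if ⌊ u ≟ x ⌋ then a else b) xs) ≡⟨ sum-map-cong xs (λ {u} u∈ → if-false (⌊≟⌋-false⁺ {x = u} {x} (λ { refl → All.lookup x∉ u∈ refl }))) ⟩
  sum (map (λ _ → b) xs)                          ≡⟨ sum-map-const xs b ⟩
  length xs * b                                   ∎)
  where open ≡-Reasoning
sum-map-if-≟ (x ∷ y ∷ ys) {u₀} a b (x∉ ∷ uniq) (there u₀∈) = begin
  (if ⌊ x ≟ u₀ ⌋ then a else b) + sum (map (λ u → if ⌊ u ≟ u₀ ⌋ then a else b) (y ∷ ys))
    ≡⟨ cong₂ _+_ (if-false (⌊≟⌋-false⁺ {x = x} {u₀} (λ { refl → All.lookup x∉ u₀∈ refl }))) (sum-map-if-≟ (y ∷ ys) a b uniq u₀∈) ⟩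
  b + (a + length ys * b)  ≡⟨ x∙yz≈y∙xz b a _ ⟩
  a + (b + length ys * b)  ∎
  where open ≡-Reasoning

-- At most one value is below b. If one is, it is at most a (it cannot be the value at u₀ when a = L, and
-- there is no room between a and b when b ≤ a + 1), and all others are at least a + b minus it.
sum-map-≥-pairwise : ∀ {n} (xs : List (Fin n)) (f : Fin n → ℕ) {u₀} (a b L : ℕ) → Unique xs → u₀ ∈ xs → 2 ≤ length xs →
  (∀ {u v} → u ∈ xs → v ∈ xs → u ≢ v → a + b ≤ f u + f v) →
  a ≤ b → f u₀ ≤ L → a ≡ L ⊎ b ≤ suc a →
  a + (length xs ∸ 1) * b ≤ sum (map f xs)
sum-map-≥-pairwise xs f {u₀} a b L uniq u₀∈ 2≤len pair a≤b fu₀≤L cases with Any.any? (λ v → f v <? b) xs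
... | no ∄small = begin
  a + (length xs ∸ 1) * b  ≤⟨ +-monoˡ-≤ _ a≤b ⟩
  b + (length xs ∸ 1) * b  ≡⟨ cong (_* b) (m+[n∸m]≡n (≤-trans (s≤s z≤n) 2≤len)) ⟩
  length xs * b            ≡⟨ sum-map-const xs b ⟨
  sum (map (λ _ → b) xs)   ≤⟨ sum-map-mono xs (λ v∈ → ≮⇒≥ (λ fv<b → ∄small (Any.map (λ { refl → fv<b }) v∈))) ⟩
  sum (map f xs)           ∎
  where open ≤-Reasoning
... | yes ∃small with find ∃small
... | v , v∈ , fv<b with f v ≤? a
...   | no fv≰a = ⊥-elim ([ u₀-small , (λ b≤1+a → fv≰a (≤-pred (≤-trans fv<b b≤1+a))) ]′ cases)
  where
  u₀-small : a ≡ L → ⊥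
  u₀-small refl = <⇒≱ fv<b (+-cancelˡ-≤ a b (f v) (≤-trans (pair u₀∈ v∈ u₀≢v) (+-monoˡ-≤ (f v) fu₀≤L)))
    where
    u₀≢v : u₀ ≢ v
    u₀≢v refl = fv≰a fu₀≤L
...   | yes fv≤a = begin
  a + (length xs ∸ 1) * b                   ≡⟨ cong₂ (λ s t → s + t * b) (m+[n∸m]≡n fv≤a) (sym len-1) ⟨
  (f v + δ) + suc k * b                     ≤⟨ trade (f v) δ b k ⟩
  f v + suc k * (δ + b)                     ≡⟨ cong (λ t → f v + suc k * t) (trans (sym (m+n∸m≡n (f v) (δ + b))) (cong (_∸ f v) (sym (+-assoc (f v) δ b)))) ⟩
  f v + suc k * ((f v + δ) + b ∸ f v)       ≡⟨ cong (λ s → f v + suc k * (s + b ∸ f v)) (m+[n∸m]≡n fv≤a) ⟩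
  f v + suc k * (a + b ∸ f v)               ≡⟨ cong (λ t → f v + t * (a + b ∸ f v)) len-1 ⟨
  f v + (length xs ∸ 1) * (a + b ∸ f v)     ≤⟨ sum-map-≥-except xs f (a + b ∸ f v) uniq v∈ (λ u∈ u≢v → others-large (pair u∈ v∈ u≢v)) ⟩
  sum (map f xs)                            ∎
  where
  open ≤-Reasoning
  δ k : ℕ
  δ = a ∸ f v
  k = length xs ∸ 2
  len-1 : length xs ∸ 1 ≡ suc k
  len-1 = trans (cong (_∸ 1) (sym (m+[n∸m]≡n 2≤len))) refl
  others-large : ∀ {u} → a + b ≤ f u + f v → a + b ∸ f v ≤ f u
  others-large {u} le = m≤n+o⇒m∸n≤o (a + b) (f v) (subst (a + b ≤_) (+-comm (f u) (f v)) le)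
  -- lowering one value by δ raises the bound on each of the k + 1 others by δ
  trade : ∀ c δ b k → (c + δ) + suc k * b ≤ c + suc k * (δ + b)
  trade c δ b k = begin
    (c + δ) + suc k * b          ≡⟨ +-assoc c δ _ ⟩
    c + (δ + suc k * b)          ≤⟨ +-monoʳ-≤ c (+-monoˡ-≤ (suc k * b) (m≤n*m δ (suc k))) ⟩
    c + (suc k * δ + suc k * b)  ≡⟨ cong (c +_) (*-distribˡ-+ (suc k) δ b) ⟨
    c + suc k * (δ + b)          ∎

Adj-sym : ∀ {n} (G : Graph n) {x y} → Adj G x y → Adj G y x
Adj-sym G {x} {y} xy = trans (Graph.sym G y x) xy

Adj⇒≢ : ∀ {n} (G : Graph n) {x y} → Adj G x y → x ≢ y
Adj⇒≢ G {x} xy refl = true≢false xy (Graph.irrefl G x)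

module Walks {n : ℕ} (G : Graph n) where

  record Walk (x y : Fin n) (k : ℕ) : Set where
    field
      vertex : ℕ → Fin n
      starts : vertex 0 ≡ x
      ends   : vertex k ≡ y
      steps  : ∀ i → i < k → Adj G (vertex i) (vertex (suc i))
  open Walk public

  first-step : ∀ {x y k} (w : Walk x y (suc k)) → Adj G x (vertex w 1)
  first-step w = subst (λ v → Adj G v (vertex w 1)) (starts w) (steps w 0 z<s)

  walk-refl : ∀ x → Walk x x 0
  walk-refl x = record { vertex = λ _ → x ; starts = refl ; ends = refl ; steps = λ _ () }

  walk-cons : ∀ {x z y k} → Adj G x z → Walk z y k → Walk x y (suc k)
  walk-cons {x} {k = k} xz w = record { vertex = v ; starts = refl ; ends = ends w ; steps = s }
    where
    v : ℕ → Fin n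
    v zero    = x
    v (suc i) = vertex w i
    s : ∀ i → i < suc k → Adj G (v i) (v (suc i))
    s zero    _         = subst (Adj G x) (sym (starts w)) xz
    s (suc i) (s≤s i<k) = steps w i i<k

  walk-take : ∀ {x y k} (w : Walk x y k) i → i ≤ k → Walk x (vertex w i) i
  walk-take w i i≤k = record
    { vertex = vertex w ; starts = starts w ; ends = refl
    ; steps = λ t t<i → steps w t (≤-trans t<i i≤k) }

  walk-drop : ∀ {x y k} (w : Walk x y k) i → i ≤ k → Walk (vertex w i) y (k ∸ i)
  walk-drop {k = k} w i i≤k = record
    { vertex = λ t → vertex w (i + t)
    ; starts = cong (vertex w) (+-identityʳ i)
    ; ends   = trans (cong (vertex w) (m+[n∸m]≡n i≤k)) (ends w)
    ; steps  = λ t t<k∸i → subst (λ u → Adj G (vertex w (i + t)) (vertex w u)) (sym (+-suc i t))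
                             (steps w (i + t) (subst (i + t <_) (m+[n∸m]≡n i≤k) (+-monoʳ-< i t<k∸i)))
    }

  walk-++ : ∀ {x y z a b} → Walk x y a → Walk y z b → Walk x z (a + b)
  walk-++ {a = a} = go a
    where
    go : ∀ {x y z b} a → Walk x y a → Walk y z b → Walk x z (a + b)
    go zero    w₁ w₂ = subst (λ v → Walk v _ _) (trans (sym (ends w₁)) (starts w₁)) w₂
    go (suc a) w₁ w₂ = walk-cons (first-step w₁) (go a (walk-drop w₁ 1 (s≤s z≤n)) w₂)

  walk-reverse : ∀ {x y k} → Walk x y k → Walk y x k
  walk-reverse {k = k} w = record
    { vertex = λ t → vertex w (k ∸ t)
    ; starts = ends w
    ; ends   = trans (cong (vertex w) (n∸n≡0 k)) (starts w)
    ; steps  = λ i i<k → subst (λ t → Adj G (vertex w t) (vertex w (k ∸ suc i))) (sym (+-∸-assoc 1 i<k))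
                           (Adj-sym G (steps w (k ∸ suc i) (∸-monoʳ-< z<s i<k)))
    }

  walk⇒reach : ∀ {x y} k → Walk x y k → reach G k x y ≡ true
  walk⇒reach {x} {y} zero    w = subst (λ t → ⌊ t ≟ y ⌋ ≡ true) (trans (sym (ends w)) (starts w)) (⌊≟⌋-refl y)
  walk⇒reach {x} {y} (suc k) w = ∨-true⁺ʳ {reach G k x y}
    (any⁺ _ (∈-allFin (vertex w 1)) (∧-true⁺ (first-step w) (walk⇒reach k (walk-drop w 1 (s≤s z≤n)))))

  reach⇒walk : ∀ {x y} k → reach G k x y ≡ true → Σ ℕ λ j → j ≤ k × Walk x y j
  reach⇒walk {x} zero e = 0 , z≤n , subst (λ y → Walk x y 0) (⌊≟⌋-true⁻ e) (walk-refl x)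
  reach⇒walk {x} {y} (suc k) e with ∨-true⁻ {reach G k x y} e
  ... | inj₁ e′ = let (j , j≤k , w) = reach⇒walk k e′ in j , m≤n⇒m≤1+n j≤k , w
  ... | inj₂ e′ with any⁻ _ (allFin n) e′
  ... | z , _ , xz∧zy = let (j , j≤k , w) = reach⇒walk k (∧-true⁻ʳ {adj G x z} xz∧zy)
                        in suc j , s≤s j≤k , walk-cons (∧-true⁻ˡ xz∧zy) w

  -- By pigeonhole a walk with at least n steps visits some vertex twice; cut out the loop.
  walk-shortcut : ∀ {x y k} → Walk x y k → n ≤ k → Σ ℕ λ k′ → k′ < k × Walk x y k′
  walk-shortcut {y = y} {k} w n≤k with pigeonhole (s≤s n≤k) (λ (i : Fin (suc k)) → vertex w (toℕ i))
  ... | i , j , i<j , same = toℕ i + (k ∸ toℕ j) , shorter ,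
        walk-++ (walk-take w (toℕ i) (≤-trans (<⇒≤ i<j) j≤k))
                (subst (λ v → Walk v y (k ∸ toℕ j)) (sym same) (walk-drop w (toℕ j) j≤k))
    where
    j≤k : toℕ j ≤ k
    j≤k = ≤-pred (toℕ<n j)
    shorter : toℕ i + (k ∸ toℕ j) < k
    shorter = subst (toℕ i + (k ∸ toℕ j) <_) (m+[n∸m]≡n j≤k) (+-monoˡ-< (k ∸ toℕ j) i<j)

  walk-shorten : ∀ {x y k} → Walk x y k → Σ ℕ λ k′ → k′ ≤ k × k′ < n × Walk x y k′
  walk-shorten {x} {y} {k} = <-rec Shorter step k
    where
    Shorter : ℕ → Set
    Shorter k = Walk x y k → Σ ℕ λ k′ → k′ ≤ k × k′ < n × Walk x y k′
    step : ∀ k → (∀ {j} → j < k → Shorter j) → Shorter k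
    step k rec w with k <? n
    ... | yes k<n = k , ≤-refl , k<n , w
    ... | no k≮n with walk-shortcut w (≮⇒≥ k≮n)
    ... | j , j<k , w′ = let (k′ , k′≤j , k′<n , w″) = rec j<k w′ in k′ , ≤-trans k′≤j (<⇒≤ j<k) , k′<n , w″

  dist≤length : ∀ {x y k} → Walk x y k → dist G x y ≤ k
  dist≤length {x} {y} w with walk-shorten w
  ... | k′ , k′≤k , k′<n , w′ =
    ≤-trans (proj₁ (search-sound (λ t → reach G t x y) 0 n k′ k′<n (walk⇒reach k′ w′))) k′≤k

  module _ (conn : Connected G) where
    abstract
      geodesic : ∀ x y → Walk x y (dist G x y)
      geodesic x y with conn x y
      ... | k , e with reach⇒walk k e
      ... | _ , _ , w with walk-shorten w
      ... | k′ , _ , k′<n , w′ with reach⇒walk (dist G x y) (proj₂ (search-sound (λ t → reach G t x y) 0 n k′ k′<n (walk⇒reach k′ w′)))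
      ... | j , j≤d , w″ = subst (Walk x y) (≤-antisym j≤d (dist≤length w″)) w″

module Metric {n : ℕ} (G : Graph n) (conn : Connected G) where
  open Walks G public

  d : Fin n → Fin n → ℕ
  d = dist G

  d-refl : ∀ x → d x x ≡ 0
  d-refl x = n≤0⇒n≡0 (dist≤length (walk-refl x))

  d≡0⇒≡ : ∀ {x y} → d x y ≡ 0 → x ≡ y
  d≡0⇒≡ {x} {y} e = trans (sym (starts w)) (trans (cong (vertex w) (sym e)) (ends w))
    where w = geodesic conn x y

  d-sym : ∀ x y → d x y ≡ d y x
  d-sym x y = ≤-antisym (dist≤length (walk-reverse (geodesic conn y x))) (dist≤length (walk-reverse (geodesic conn x y)))

  d-triangle : ∀ x y z → d x z ≤ d x y + d y z
  d-triangle x y z = dist≤length (walk-++ (geodesic conn x y) (geodesic conn y z))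

  d-pos : ∀ {x y} → x ≢ y → 1 ≤ d x y
  d-pos {x} {y} x≢y with d x y in eq
  ... | zero  = ⊥-elim (x≢y (d≡0⇒≡ eq))
  ... | suc _ = s≤s z≤n

  d-adj : ∀ {x y} → Adj G x y → d x y ≡ 1
  d-adj {x} {y} xy = ≤-antisym (dist≤length (walk-cons xy (walk-refl y))) (d-pos (Adj⇒≢ G xy))

  d-adj-≤ : ∀ {x y} z → Adj G x y → d x z ≤ suc (d y z)
  d-adj-≤ {x} {y} z xy = subst (λ t → d x z ≤ t + d y z) (d-adj xy) (d-triangle x y z)

  geo : Fin n → Fin n → ℕ → Fin n
  geo x y = vertex (geodesic conn x y)

  geo-start : ∀ x y → geo x y 0 ≡ x
  geo-start x y = starts (geodesic conn x y)

  geo-end : ∀ x y → geo x y (d x y) ≡ y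
  geo-end x y = ends (geodesic conn x y)

  geo-adj : ∀ x y i → i < d x y → Adj G (geo x y i) (geo x y (suc i))
  geo-adj x y = steps (geodesic conn x y)

  d-geo : ∀ x y i → i ≤ d x y → d x (geo x y i) ≡ i
  d-geo x y i i≤d = ≤-antisym (dist≤length (walk-take w i i≤d)) (+-cancelʳ-≤ (d x y ∸ i) i (d x g) i+rest≤)
    where
    w = geodesic conn x y
    g = geo x y i
    i+rest≤ : i + (d x y ∸ i) ≤ d x g + (d x y ∸ i)
    i+rest≤ = subst (_≤ d x g + (d x y ∸ i)) (sym (m+[n∸m]≡n i≤d))
                (≤-trans (d-triangle x g y) (+-monoʳ-≤ (d x g) (dist≤length (walk-drop w i i≤d))))

  d-geo-end : ∀ x y i → i ≤ d x y → d (geo x y i) y ≡ d x y ∸ i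
  d-geo-end x y i i≤d = ≤-antisym (dist≤length (walk-drop (geodesic conn x y) i i≤d))
    (m≤n+o⇒m∸n≤o (d x y) i (subst (λ t → d x y ≤ t + d g y) (d-geo x y i i≤d) (d-triangle x g y)))
    where g = geo x y i

  geo-between : ∀ x y i → i ≤ d x y → d x (geo x y i) + d (geo x y i) y ≡ d x y
  geo-between x y i i≤d = trans (cong₂ _+_ (d-geo x y i i≤d) (d-geo-end x y i i≤d)) (m+[n∸m]≡n i≤d)

  geo-injective : ∀ x y s t → s ≤ d x y → t ≤ d x y → geo x y s ≡ geo x y t → s ≡ t
  geo-injective x y s t s≤d t≤d e = trans (sym (d-geo x y s s≤d)) (trans (cong (d x) e) (d-geo x y t t≤d))

  NextHop : Fin n → Fin n → Fin n → Set
  NextHop m z p = Adj G m p × suc (d p z) ≡ d m z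

  next-hop : ∀ {x y} → x ≢ y → Σ (Fin n) (NextHop x y)
  next-hop {x} {y} x≢y = geo x y 1 , subst (λ v → Adj G v (geo x y 1)) (geo-start x y) (geo-adj x y 0 1≤d) ,
    trans (cong suc (d-geo-end x y 1 1≤d)) (m+[n∸m]≡n 1≤d)
    where 1≤d = d-pos x≢y

  next-hop⇒≢ : ∀ {m z p} → NextHop m z p → m ≢ z
  next-hop⇒≢ {m} (_ , e) refl = 1+n≢0 (trans e (d-refl m))

  next-hop-adj : ∀ {m y} → Adj G m y → NextHop m y y
  next-hop-adj {m} {y} my = my , trans (cong suc (d-refl y)) (sym (d-adj my))

  next-hop-extend : ∀ {v z u p} → d v z + d z u ≡ d v u → NextHop v z p → NextHop v u p
  next-hop-extend {v} {z} {u} {p} between (vp , e) = vp , ≤-antisym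
    (≤-trans (s≤s (d-triangle p z u)) (≤-reflexive (trans (cong (_+ d z u) e) between)))
    (d-adj-≤ u vp)

degree≡count : ∀ {n} (G : Graph n) v → degree G v ≡ count (adj G v)
degree≡count G v = length-filter-allFin (adj G v)

degree≥1 : ∀ {n} (G : Graph n) {v a} → Adj G v a → 1 ≤ degree G v
degree≥1 G {v} {a} va = subst (1 ≤_) (sym (degree≡count G v)) (length≤count (a ∷ []) (All.[] ∷ []) λ { _ (here refl) → va })

degree≥2 : ∀ {n} (G : Graph n) {v a b} → Adj G v a → Adj G v b → a ≢ b → 2 ≤ degree G v
degree≥2 G {v} va vb a≢b = subst (2 ≤_) (sym (degree≡count G v)) (count≥2 (adj G v) va vb a≢b)

degree≤1 : ∀ {n} (G : Graph n) {v p} → (∀ c → Adj G v c → c ≡ p) → degree G v ≤ 1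
degree≤1 G {v} {p} only = subst (_≤ 1) (sym (degree≡count G v)) (count≤length (p ∷ []) (λ c vc → here (only c vc)))

∃-neighbour-∉ : ∀ {n} (G : Graph n) {v} (xs : List (Fin n)) → length xs < degree G v → Σ (Fin n) λ x → Adj G v x × x ∉ xs
∃-neighbour-∉ G {v} xs lt = ∃-∉ (adj G v) xs (subst (length xs <_) (degree≡count G v) lt)

isMajor⁻ : ∀ {n} (G : Graph n) {v} → isMajor G v ≡ true → 3 ≤ degree G v
isMajor⁻ G = ≤ᵇ-true⁻

¬isMajor⁺ : ∀ {n} (G : Graph n) {v} → degree G v ≤ 2 → isMajor G v ≡ false
¬isMajor⁺ G {v} deg≤2 with true⊎false (isMajor G v)
... | inj₁ major = ⊥-elim (<⇒≱ (isMajor⁻ G major) deg≤2)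
... | inj₂ minor = minor

¬isMajor⁻ : ∀ {n} (G : Graph n) {v} → isMajor G v ≡ false → degree G v ≤ 2
¬isMajor⁻ G minor = ≤-pred (≤ᵇ-false⁻ minor)

degree≤2-neighbour : ∀ {n} (G : Graph n) {v a b c} → degree G v ≤ 2 → Adj G v a → Adj G v b → a ≢ b → Adj G v c → c ≡ a ⊎ c ≡ b
degree≤2-neighbour G {a = a} {b} {c} deg≤2 va vb a≢b vc with c ≟ a | c ≟ b
... | yes c≡a | _       = inj₁ c≡a
... | no _    | yes c≡b = inj₂ c≡b
... | no c≢a  | no c≢b  = ⊥-elim (<⇒≱ (subst (3 ≤_) (sym (degree≡count G _)) (count≥3 (adj G _) va vb vc a≢b (c≢a ∘ sym) (c≢b ∘ sym))) deg≤2)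

module Tree {n : ℕ} (G : Graph n) (conn : Connected G) (acyc : Acyclic G) where
  open Metric G conn public

  -- The cycle v, α 0, …, α i = β j, β (j ∸ 1), …, β 0, where α and β are the geodesics from a and b
  -- to z and i is the first index at which α meets β.
  module MeetingCycle (z v a b : Fin n) (va : Adj G v a) (vb : Adj G v b) (a≢b : a ≢ b)
           (a-closer : d a z ≤ d v z) (b-closer : d b z ≤ d v z) (i j : ℕ) (i≤A : i ≤ d a z) (j≤B : j ≤ d b z)
           (meet : geo a z i ≡ geo b z j)
           (first : ∀ i′ → i′ < i → ¬ (Σ ℕ λ j′ → j′ ≤ d b z × geo a z i′ ≡ geo b z j′)) where
    α β : ℕ → Fin n
    α = geo a z
    β = geo b z

    cyc : ℕ → Fin n
    cyc zero    = v
    cyc (suc t) with t ≤? i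
    ... | yes _ = α t
    ... | no _  = β (i + j ∸ t)

    cyc-α : ∀ t → t ≤ i → cyc (suc t) ≡ α t
    cyc-α t t≤i with t ≤? i
    ... | yes _  = refl
    ... | no t≰i = ⊥-elim (t≰i t≤i)

    cyc-β : ∀ t → i < t → cyc (suc t) ≡ β (i + j ∸ t)
    cyc-β t i<t with t ≤? i
    ... | yes t≤i = ⊥-elim (<⇒≱ i<t t≤i)
    ... | no _    = refl

    K : ℕ
    K = suc (i + j)

    data Position (p : ℕ) : Set where
      at-v : p ≡ 0 → Position p
      on-α : ∀ t → p ≡ suc t → t ≤ i → Position p
      on-β : ∀ t → p ≡ suc t → i < t → Position p

    position : ∀ p → Position p
    position zero = at-v refl
    position (suc t) with t ≤? i
    ... | yes t≤i = on-α t refl t≤i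
    ... | no t≰i  = on-β t refl (≰⇒> t≰i)

    β-index< : ∀ t → i < t → t ≤ i + j → i + j ∸ t < j
    β-index< t i<t t≤ = subst (i + j ∸ t <_) (m+n∸m≡n i j) (∸-monoʳ-< i<t t≤)

    geo-avoids : ∀ x → Adj G v x → d x z ≤ d v z → ∀ t → t ≤ d x z → geo x z t ≢ v
    geo-avoids x vx x-closer t t≤ gt≡v = <⇒≱ (≤-trans v-closer x-closer) ≤-refl
      where
      t≡1 : t ≡ 1
      t≡1 = trans (sym (d-geo x z t t≤)) (trans (cong (d x) gt≡v) (d-adj (Adj-sym G vx)))
      v-closer : d v z < d x z
      v-closer = subst (_< d x z) (trans (cong (d x z ∸_) (sym t≡1)) (trans (sym (d-geo-end x z t t≤)) (cong (λ u → d u z) gt≡v)))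
                   (∸-monoʳ-< z<s (subst (_≤ d x z) t≡1 t≤))

    distinct : ∀ s t → 0 ≤ s → s < t → t < 0 + suc K → cyc s ≢ cyc t
    distinct s t _ s<t t<K with position s | position t
    ... | _ | at-v refl = λ _ → <⇒≱ s<t z≤n
    ... | at-v refl | on-α t′ refl t′≤i = λ e → geo-avoids a va a-closer t′ (≤-trans t′≤i i≤A) (sym (trans e (cyc-α t′ t′≤i)))
    ... | at-v refl | on-β t′ refl i<t′ = λ e → geo-avoids b vb b-closer (i + j ∸ t′) (≤-trans (<⇒≤ (β-index< t′ i<t′ (≤-pred (≤-pred t<K)))) j≤B) (sym (trans e (cyc-β t′ i<t′)))
    ... | on-α s′ refl s′≤i | on-α t′ refl t′≤i = λ e → <⇒≢ (≤-pred s<t) (geo-injective a z s′ t′ (≤-trans s′≤i i≤A) (≤-trans t′≤i i≤A) (trans (sym (cyc-α s′ s′≤i)) (trans e (cyc-α t′ t′≤i))))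
    ... | on-α s′ refl s′≤i | on-β t′ refl i<t′ = λ e → α≢β s′≤i (β-index< t′ i<t′ (≤-pred (≤-pred t<K))) (trans (sym (cyc-α s′ s′≤i)) (trans e (cyc-β t′ i<t′)))
      where
      α≢β : ∀ {s′ q} → s′ ≤ i → q < j → α s′ ≡ β q → ⊥
      α≢β {s′} {q} s′≤i q<j e with m≤n⇒m<n∨m≡n s′≤i
      ... | inj₁ s′<i = first s′ s′<i (q , ≤-trans (<⇒≤ q<j) j≤B , e)
      ... | inj₂ refl = <⇒≢ q<j (geo-injective b z q j (≤-trans (<⇒≤ q<j) j≤B) j≤B (trans (sym e) meet))
    ... | on-β s′ refl i<s′ | on-α t′ refl t′≤i = λ _ → <⇒≱ (≤-pred s<t) (≤-trans t′≤i (<⇒≤ i<s′))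
    ... | on-β s′ refl i<s′ | on-β t′ refl i<t′ = λ e → <⇒≢ (≤-pred s<t)
            (∸-cancelˡ-≡ s′≤ t′≤ (geo-injective b z _ _ (≤-trans (<⇒≤ (β-index< s′ i<s′ s′≤)) j≤B) (≤-trans (<⇒≤ (β-index< t′ i<t′ t′≤)) j≤B)
              (trans (sym (cyc-β s′ i<s′)) (trans e (cyc-β t′ i<t′)))))
      where
      t′≤ : t′ ≤ i + j
      t′≤ = ≤-pred (≤-pred t<K)
      s′≤ : s′ ≤ i + j
      s′≤ = ≤-trans (<⇒≤ (≤-pred s<t)) t′≤

    adjacent : ∀ t → 0 ≤ t → t < 0 + K → Adj G (cyc t) (cyc (suc t))
    adjacent zero _ _ = subst (Adj G v) (sym (trans (cyc-α 0 z≤n) (geo-start a z))) va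
    adjacent (suc t) _ t<K with <-cmp t i
    ... | tri< t<i _ _ = subst₂ (Adj G) (sym (cyc-α t (<⇒≤ t<i))) (sym (cyc-α (suc t) t<i)) (geo-adj a z t (<-≤-trans t<i i≤A))
    ... | tri≈ _ refl _ = subst₂ (Adj G) (sym (trans (cyc-α t ≤-refl) meet)) (sym (cyc-β (suc t) ≤-refl))
            (Adj-sym G (subst (λ u → Adj G (β (t + j ∸ suc t)) (β u)) (trans (sym (+-∸-assoc 1 (≤-pred t<K))) (m+n∸m≡n t j))
              (geo-adj b z (t + j ∸ suc t) (<-≤-trans (subst (t + j ∸ suc t <_) (trans (sym (+-∸-assoc 1 (≤-pred t<K))) (m+n∸m≡n t j)) ≤-refl) j≤B))))
    ... | tri> _ _ i<t = subst₂ (Adj G) (sym (cyc-β t i<t)) (sym (cyc-β (suc t) (m<n⇒m<1+n i<t)))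
            (Adj-sym G (subst (λ u → Adj G (β (i + j ∸ suc t)) (β u)) (sym (+-∸-assoc 1 (≤-pred t<K)))
              (geo-adj b z (i + j ∸ suc t) (<-≤-trans (β-index< (suc t) (m<n⇒m<1+n i<t) (≤-pred t<K)) j≤B))))

    closes : Adj G (cyc (0 + K)) v
    closes with position K
    ... | on-α _ refl i+j≤i = subst (λ u → Adj G u v) (sym (trans (cyc-α (i + j) i+j≤i) α-end≡b)) (Adj-sym G vb)
      where
      j≡0 : j ≡ 0
      j≡0 = n≤0⇒n≡0 (+-cancelˡ-≤ i j 0 (subst (i + j ≤_) (sym (+-identityʳ i)) i+j≤i))
      α-end≡b : α (i + j) ≡ b
      α-end≡b = trans (cong (λ t → α (i + t)) j≡0) (trans (cong α (+-identityʳ i)) (trans meet (trans (cong β j≡0) (geo-start b z))))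
    ... | on-β _ refl i<i+j = subst (λ u → Adj G u v) (sym (trans (cyc-β (i + j) i<i+j) (trans (cong β (n∸n≡0 (i + j))) (geo-start b z)))) (Adj-sym G vb)

    cycle : IsCycle G (cyc 0 ∷ segment cyc 1 K)
    cycle = subst (2 ≤_) (sym (length-segment cyc 1 K)) (s≤s 1≤i+j) , segment-unique cyc 0 (suc K) distinct ,
            segment-linked (Adj G) cyc 0 K v adjacent closes
      where
      1≤i+j : 1 ≤ i + j
      1≤i+j = n≢0⇒n>0 λ i+j≡0 → a≢b (trans (sym (geo-start a z)) (trans
                (subst₂ (λ s t → geo a z s ≡ geo b z t) (m+n≡0⇒m≡0 i i+j≡0) (m+n≡0⇒n≡0 i i+j≡0) meet) (geo-start b z)))

  closer-neighbour-unique : ∀ {z v a b} → Adj G v a → Adj G v b → d a z ≤ d v z → d b z ≤ d v z → a ≡ b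
  closer-neighbour-unique {z} {v} {a} {b} va vb a-closer b-closer with a ≟ b
  ... | yes a≡b = a≡b
  ... | no a≢b with minimal-witness Meets meets? (d a z) (d b z , ≤-refl , trans (geo-end a z) (sym (geo-end b z)))
    where
    Meets : ℕ → Set
    Meets i = Σ ℕ λ j → j ≤ d b z × geo a z i ≡ geo b z j
    meets? : ∀ i → Dec (Meets i)
    meets? i = ∃≤? (λ j → geo a z i ≡ geo b z j) (λ j → geo a z i ≟ geo b z j) (d b z)
  ... | i , i≤A , (j , j≤B , meet) , first =
    ⊥-elim (acyc _ (MeetingCycle.cycle z v a b va vb a≢b a-closer b-closer i j i≤A j≤B meet first))

  next-hop-unique : ∀ {m z p q} → NextHop m z p → NextHop m z q → p ≡ q
  next-hop-unique (mp , ep) (mq , eq) = closer-neighbour-unique mp mq (subst (_ ≤_) ep (n≤1+n _)) (subst (_ ≤_) eq (n≤1+n _))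

  adj⇒d≢ : ∀ {x y} z → Adj G x y → d x z ≢ d y z
  adj⇒d≢ {x} {y} z xy dx≡dy with y ≟ z
  ... | yes refl = Adj⇒≢ G xy (d≡0⇒≡ (trans dx≡dy (d-refl y)))
  ... | no y≢z with next-hop y≢z
  ... | y′ , yy′ , ey′ = 1+n≢n (trans ey′ (trans (sym dx≡dy) (cong (λ t → d t z) x≡y′)))
    where
    x≡y′ : x ≡ y′
    x≡y′ = closer-neighbour-unique (Adj-sym G xy) yy′ (≤-reflexive dx≡dy) (subst (d y′ z ≤_) ey′ (n≤1+n _))

  adj⇒d-suc : ∀ {x y} z → Adj G x y → d x z ≡ suc (d y z) ⊎ d y z ≡ suc (d x z)
  adj⇒d-suc {x} {y} z xy with <-cmp (d x z) (d y z)
  ... | tri≈ _ dx≡dy _ = ⊥-elim (adj⇒d≢ z xy dx≡dy)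
  ... | tri< dx<dy _ _ = inj₂ (≤-antisym (d-adj-≤ z (Adj-sym G xy)) dx<dy)
  ... | tri> _ _ dy<dx = inj₁ (≤-antisym (d-adj-≤ z xy) dy<dx)

  d≡1⇒adj : ∀ {x y} → d x y ≡ 1 → Adj G x y
  d≡1⇒adj {x} {y} e with next-hop {x} {y} (λ { refl → 1+n≢0 (trans (sym e) (d-refl x)) })
  ... | z , xz , ez = subst (Adj G x) (d≡0⇒≡ (suc-injective (trans ez e))) xz

  next-hop-restrict : ∀ {v z u q} → d v z + d z u ≡ d v u → z ≢ v → NextHop v u q → NextHop v z q
  next-hop-restrict between z≢v hop-u with next-hop (z≢v ∘ sym)
  ... | p , hop-z = subst (NextHop _ _) (next-hop-unique (next-hop-extend between hop-z) hop-u) hop-z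

  next-hop-retarget : ∀ {v z p c} → NextHop z v p → p ≢ v → NextHop v z c → NextHop v p c
  next-hop-retarget {v} {z} {p} (zp , ep) p≢v hop =
    next-hop-restrict (trans (cong₂ _+_ (d-sym v p) (d-adj (Adj-sym G zp))) (trans (+-comm (d p v) 1) (trans ep (d-sym z v)))) p≢v hop

  d-through : ∀ {m y z p q} → NextHop m y p → NextHop m z q → p ≢ q → d y z ≡ d y m + d m z
  d-through {m} {y} {z} {p} {q} hop-y hop-z p≢q with d y m in eq
  ... | zero  = ⊥-elim (next-hop⇒≢ hop-y (sym (d≡0⇒≡ eq)))
  ... | suc k = subst (λ t → d y z ≡ t + d m z) eq (go k y eq hop-y)
    where
    go : ∀ k y → d y m ≡ suc k → NextHop m y p → d y z ≡ d y m + d m z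
    go zero y e hop with adj⇒d-suc z (d≡1⇒adj e)
    ... | inj₁ dy≡1+dm = trans dy≡1+dm (cong (_+ d m z) (sym e))
    ... | inj₂ dm≡1+dy = ⊥-elim (p≢q (trans (next-hop-unique hop (next-hop-adj (Adj-sym G (d≡1⇒adj e))))
                                           (next-hop-unique (Adj-sym G (d≡1⇒adj e) , sym dm≡1+dy) hop-z)))
    go (suc k) y e hop = step (go k y′ dy′m (next-hop-retarget (yy′ , ey′) y′≢m hop)) (adj⇒d-suc z yy′)
      where
      toward-m : Σ (Fin n) (NextHop y m)
      toward-m = next-hop {y} {m} (λ { refl → 1+n≢0 (trans (sym e) (d-refl y)) })
      y′ : Fin n
      y′ = proj₁ toward-m
      yy′ : Adj G y y′
      yy′ = proj₁ (proj₂ toward-m)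
      ey′ : suc (d y′ m) ≡ d y m
      ey′ = proj₂ (proj₂ toward-m)
      dy′m : d y′ m ≡ suc k
      dy′m = suc-injective (trans ey′ e)
      y′≢m : y′ ≢ m
      y′≢m y′≡m = 1+n≢0 (trans (sym dy′m) (trans (cong (d y′) (sym y′≡m)) (d-refl y′)))
      step : d y′ z ≡ d y′ m + d m z → d y z ≡ suc (d y′ z) ⊎ d y′ z ≡ suc (d y z) → d y z ≡ d y m + d m z
      step ih (inj₁ dy≡1+dy′) = trans dy≡1+dy′ (trans (cong suc ih) (cong (_+ d m z) ey′))
      step ih (inj₂ dy′≡1+dy) = ⊥-elim (m+1+n≢n 1 (trans (cong suc ey′) (subst (λ t → suc (d t m) ≡ d y′ m) p≡y (proj₂ hop′))))
        where
        hop′ : NextHop y′ m (proj₁ (next-hop y′≢m))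
        hop′ = proj₂ (next-hop y′≢m)
        p≡y : proj₁ (next-hop y′≢m) ≡ y
        p≡y = next-hop-unique (next-hop-extend (sym ih) hop′) (Adj-sym G yy′ , sym dy′≡1+dy)

  odd-d : ∀ r x z → odd (d x z) ≡ odd (d x r) xor odd (d z r)
  odd-d r x z = go (d x z) x refl
    where
    go : ∀ k x → d x z ≡ k → odd k ≡ odd (d x r) xor odd (d z r)
    go zero x e rewrite d≡0⇒≡ e = sym (BoolP.xor-same (odd (d z r)))
    go (suc k) x e with next-hop {x} {z} (λ { refl → 1+n≢0 (trans (sym e) (d-refl x)) })
    ... | x′ , xx′ , ex′ with go k x′ (suc-injective (trans ex′ e)) | adj⇒d-suc r xx′
    ... | ih | inj₁ dx≡1+dx′ = trans (cong not ih) (trans (BoolP.not-distribˡ-xor (odd (d x′ r)) _) (cong (λ t → odd t xor odd (d z r)) (sym dx≡1+dx′)))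
    ... | ih | inj₂ dx′≡1+dx = trans (cong not ih) (trans (cong (λ t → not (odd t xor odd (d z r))) dx′≡1+dx)
                                 (trans (cong not (sym (BoolP.not-distribˡ-xor (odd (d x r)) _))) (BoolP.not-involutive _)))

  equidistant⇒even : ∀ x y z → d x z ≡ d y z → odd (d x y) ≡ false
  equidistant⇒even x y z e = trans (odd-d z x y) (trans (cong (λ t → odd t xor odd (d y z)) e) (BoolP.xor-same (odd (d y z))))

  next-hop-geo : ∀ {v u q} k → 1 ≤ k → k ≤ d v u → NextHop v u q → NextHop v (geo v u k) q
  next-hop-geo {v} {u} k 1≤k k≤d = next-hop-restrict (geo-between v u k k≤d)
    (λ gk≡v → <⇒≢ 1≤k (sym (trans (sym (d-geo v u k k≤d)) (trans (cong (d v) gk≡v) (d-refl v)))))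

  d-behind : ∀ {w c x z} → NextHop w x c → ¬ NextHop w z c → d x z ≡ d x w + d w z
  d-behind {w} {c} {x} {z} hop-x ¬hop-z with z ≟ w
  ... | yes refl = sym (trans (cong (d x z +_) (d-refl z)) (+-identityʳ _))
  ... | no z≢w with next-hop (z≢w ∘ sym)
  ... | p , hop-z = d-through hop-x hop-z (λ { refl → ¬hop-z hop-z })

  -- z lies in the branch at m through its neighbour c
  branch : Fin n → Fin n → Fin n → Bool
  branch m c z = suc (d c z) ≡ᵇ d m z

  branch⁺ : ∀ {m c z} → NextHop m z c → branch m c z ≡ true
  branch⁺ (_ , e) = ≡ᵇ-true⁺ e

  branch⁻ : ∀ {m c z} → Adj G m c → branch m c z ≡ true → NextHop m z c
  branch⁻ mc e = mc , ≡ᵇ-true⁻ e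

  module Path (v u : Fin n) (u≢v : u ≢ v) (u-leaf : degree G u ≤ 1)
              (inner : ∀ k → 1 ≤ k → k < d v u → degree G (geo v u k) ≤ 2) where
    g : ℕ → Fin n
    g = geo v u

    1≤d : 1 ≤ d v u
    1≤d = d-pos (u≢v ∘ sym)

    first-hop : NextHop v u (g 1)
    first-hop = proj₂ (next-hop (u≢v ∘ sym))

    on-path : ∀ k z → d v z ≡ suc k → NextHop v z (g 1) → suc k ≤ d v u × z ≡ g (suc k)
    on-path zero z e hop = 1≤d , next-hop-unique (next-hop-adj (d≡1⇒adj e)) hop
    on-path (suc k) z e hop with next-hop {z} {v} (λ { refl → 1+n≢0 (trans (sym e) (d-refl z)) })
    ... | p , zp , ep = next-on-path (m≤n⇒m<n∨m≡n 1+k≤d)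
      where
      dvp : d v p ≡ suc k
      dvp = trans (d-sym v p) (suc-injective (trans ep (trans (d-sym z v) e)))
      p≢v : p ≢ v
      p≢v refl = 1+n≢0 (trans (sym dvp) (d-refl p))
      ih : suc k ≤ d v u × p ≡ g (suc k)
      ih = on-path k p dvp (next-hop-retarget (zp , ep) p≢v hop)
      1+k≤d : suc k ≤ d v u
      1+k≤d = proj₁ ih
      p≡g : p ≡ g (suc k)
      p≡g = proj₂ ih
      level : ∀ t → t ≤ d v u → d v (g t) ≡ t
      level t = d-geo v u t
      back : Adj G (g (suc k)) (g k)
      back = Adj-sym G (geo-adj v u k 1+k≤d)
      forth : Adj G (g (suc k)) z
      forth = subst (λ t → Adj G t z) p≡g (Adj-sym G zp)
      z≢gk : z ≢ g k
      z≢gk z≡gk = m+1+n≢n 1 (trans (sym e) (trans (cong (d v) z≡gk) (level k (<⇒≤ 1+k≤d))))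
      next-on-path : suc k < d v u ⊎ suc k ≡ d v u → suc (suc k) ≤ d v u × z ≡ g (suc (suc k))
      next-on-path (inj₁ 1+k<d) = 1+k<d , [ ⊥-elim ∘ z≢gk , id ]′
        (degree≤2-neighbour G (inner (suc k) (s≤s z≤n) 1+k<d) back (geo-adj v u (suc k) 1+k<d) gk≢gk+2 forth)
        where
        gk≢gk+2 : g k ≢ g (suc (suc k))
        gk≢gk+2 e′ = m+1+n≢n 1 (trans (sym (level (suc (suc k)) 1+k<d)) (trans (cong (d v) (sym e′)) (level k (<⇒≤ 1+k≤d))))
      next-on-path (inj₂ 1+k≡d) = ⊥-elim (<⇒≱ (degree≥2 G back forth (z≢gk ∘ sym))
        (subst (λ t → degree G t ≤ 1) (sym (trans (cong g 1+k≡d) (geo-end v u))) u-leaf))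

    branch-is-path : ∀ z → NextHop v z (g 1) → 1 ≤ d v z × d v z ≤ d v u × z ≡ g (d v z)
    branch-is-path z hop = by-distance (d v z) refl
      where
      by-distance : ∀ k → d v z ≡ k → 1 ≤ d v z × d v z ≤ d v u × z ≡ g (d v z)
      by-distance zero    e = ⊥-elim (next-hop⇒≢ hop (d≡0⇒≡ e))
      by-distance (suc k) e = subst (λ t → 1 ≤ t × t ≤ d v u × z ≡ g t) (sym e) (s≤s z≤n , on-path k z e hop)

  terminal⇒degree≡1 : ∀ {u w} → isTerminal G u w ≡ true → degree G u ≡ 1
  terminal⇒degree≡1 e = ≡ᵇ-true⁻ (∧-true⁻ˡ e)

  terminal⇒major : ∀ {u w} → isTerminal G u w ≡ true → isMajor G w ≡ true
  terminal⇒major {u} e = ∧-true⁻ˡ (∧-true⁻ʳ {degree G u ≡ᵇ 1} e)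

  terminal-closest : ∀ {u w} → isTerminal G u w ≡ true → ∀ {w′} → isMajor G w′ ≡ true → w′ ≢ w → d u w < d u w′
  terminal-closest {u} {w} e {w′} major w′≢w
    with ∨-true⁻ {not (isMajor G w′)} (all⁻ _ (∧-true⁻ʳ {isMajor G w} (∧-true⁻ʳ {degree G u ≡ᵇ 1} e)) (∈-allFin w′))
  ... | inj₁ minor = ⊥-elim (true≢false major (not-true⁻ minor))
  ... | inj₂ e′ with ∨-true⁻ {⌊ w′ ≟ w ⌋} e′
  ...   | inj₁ w′≡w = ⊥-elim (w′≢w (⌊≟⌋-true⁻ w′≡w))
  ...   | inj₂ closer = <ᵇ-true⁻ closer

  major⇒≢leaf : ∀ {u w} → isMajor G w ≡ true → degree G u ≡ 1 → u ≢ w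
  major⇒≢leaf major deg≡1 refl = <⇒≱ (isMajor⁻ G major) (≤-trans (≤-reflexive deg≡1) (s≤s z≤n))

  module MajorFreeBranch (v q : Fin n) (vq : Adj G v q) (minor : ∀ z → NextHop v z q → isMajor G z ≡ false) where
    farthest : Σ (Fin n) λ z → branch v q z ≡ true × (∀ z′ → branch v q z′ ≡ true → d v z′ ≤ d v z)
    farthest = argmax (branch v q) (d v) q (branch⁺ (next-hop-adj vq))

    leaf : Fin n
    leaf = proj₁ farthest

    leaf-in-branch : NextHop v leaf q
    leaf-in-branch = branch⁻ vq (proj₁ (proj₂ farthest))

    leaf≢v : leaf ≢ v
    leaf≢v e = next-hop⇒≢ leaf-in-branch (sym e)

    toward-v : Σ (Fin n) (NextHop leaf v)
    toward-v = next-hop leaf≢v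

    only-neighbour : ∀ c → Adj G leaf c → c ≡ proj₁ toward-v
    only-neighbour c leaf-c = [ (λ closer → next-hop-unique (leaf-c , sym closer) (proj₂ toward-v)) , ⊥-elim ∘ farther ]′
                                (adj⇒d-suc v leaf-c)
      where
      farther : d c v ≡ suc (d leaf v) → ⊥
      farther e = <⇒≱ (s≤s ≤-refl) (subst (_≤ d v leaf) dvc (proj₂ (proj₂ farthest) c (branch⁺ (next-hop-extend between leaf-in-branch))))
        where
        dvc : d v c ≡ suc (d v leaf)
        dvc = trans (d-sym v c) (trans e (cong suc (d-sym leaf v)))
        between : d v leaf + d leaf c ≡ d v c
        between = trans (cong (d v leaf +_) (d-adj leaf-c)) (trans (+-comm (d v leaf) 1) (sym dvc))

    leaf-degree : degree G leaf ≡ 1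
    leaf-degree = ≤-antisym (degree≤1 G only-neighbour) (degree≥1 G (proj₁ (proj₂ toward-v)))

    open Path v leaf leaf≢v (≤-reflexive leaf-degree)
      (λ k 1≤k k<d → ¬isMajor⁻ G (minor _ (next-hop-geo k 1≤k (<⇒≤ k<d) leaf-in-branch)))

    first-hop≡q : geo v leaf 1 ≡ q
    first-hop≡q = next-hop-unique first-hop leaf-in-branch

    leaf-terminal : isMajor G v ≡ true → isTerminal G leaf v ≡ true
    leaf-terminal v-major = ∧-true⁺ (≡ᵇ-true⁺ leaf-degree) (∧-true⁺ v-major (all⁺ _ (allFin n) closest))
      where
      closest : ∀ w → (not (isMajor G w) ∨ (⌊ w ≟ v ⌋ ∨ (dist G leaf v <ᵇ dist G leaf w))) ≡ true
      closest w with true⊎false (isMajor G w)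
      ... | inj₂ w-minor = ∨-true⁺ˡ (not-true⁺ w-minor)
      ... | inj₁ w-major with w ≟ v
      ...   | yes refl = ∨-true⁺ʳ {not (isMajor G w)} refl
      ...   | no w≢v with next-hop (w≢v ∘ sym)
      ...     | p , hop-w = ∨-true⁺ʳ {not (isMajor G w)} (<ᵇ-true⁺
                  (subst (d leaf v <_) (sym (d-through leaf-in-branch hop-w q≢p)) (m<m+n (d leaf v) (d-pos (w≢v ∘ sym)))))
        where
        q≢p : q ≢ p
        q≢p refl = true≢false w-major (minor w hop-w)

  leg : Fin n → Fin n → Fin n → Bool
  leg w u = branch w (geo w u 1)

  leg-prefix : Fin n → Fin n → ℕ → Fin n → Bool
  leg-prefix w u s z = leg w u z ∧ (d w z ≤ᵇ s)

  module Leg (w u : Fin n) (terminal : isTerminal G u w ≡ true) where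
    u≢w : u ≢ w
    u≢w = major⇒≢leaf (terminal⇒major terminal) (terminal⇒degree≡1 terminal)

    inner : ∀ k → 1 ≤ k → k < d w u → degree G (geo w u k) ≤ 2
    inner k 1≤k k<d with true⊎false (isMajor G (geo w u k))
    ... | inj₂ minor = ¬isMajor⁻ G minor
    ... | inj₁ major = ⊥-elim (<⇒≱ (terminal-closest terminal major gk≢w) closer)
      where
      gk≢w : geo w u k ≢ w
      gk≢w e = <⇒≢ 1≤k (sym (trans (sym (d-geo w u k (<⇒≤ k<d))) (trans (cong (d w) e) (d-refl w))))
      closer : d u (geo w u k) ≤ d u w
      closer = subst₂ _≤_ (sym (trans (d-sym u _) (d-geo-end w u k (<⇒≤ k<d)))) (d-sym w u) (m∸n≤m (d w u) k)

    open Path w u u≢w (≤-reflexive (terminal⇒degree≡1 terminal)) inner public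

    start : Fin n
    start = geo w u 1

    w-start : Adj G w start
    w-start = proj₁ first-hop

    in-leg : ∀ {z} → branch w start z ≡ true → NextHop w z start
    in-leg = branch⁻ w-start

    leg-minor : ∀ z → NextHop w z start → isMajor G z ≡ false
    leg-minor z hop with branch-is-path z hop
    ... | 1≤ , ≤d , z≡ = subst (λ t → isMajor G t ≡ false) (sym z≡) ([ (λ lt → ¬isMajor⁺ G (inner (d w z) 1≤ lt)) , at-u ]′ (m≤n⇒m<n∨m≡n ≤d))
      where
      at-u : d w z ≡ d w u → isMajor G (geo w u (d w z)) ≡ false
      at-u e = subst (λ t → isMajor G t ≡ false) (sym (trans (cong (geo w u) e) (geo-end w u)))
                 (¬isMajor⁺ G (≤-trans (≤-reflexive (terminal⇒degree≡1 terminal)) (s≤s z≤n)))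

    major∉leg : ∀ {z} → isMajor G z ≡ true → ¬ NextHop w z start
    major∉leg major hop = true≢false major (leg-minor _ hop)

    prefix⁺ : ∀ {s z} → NextHop w z start → d w z ≤ s → leg-prefix w u s z ≡ true
    prefix⁺ hop le = ∧-true⁺ (branch⁺ hop) (≤ᵇ-true⁺ le)

    prefix⁻ : ∀ {s z} → leg-prefix w u s z ≡ true → NextHop w z start × d w z ≤ s
    prefix⁻ {s} {z} e = in-leg (∧-true⁻ˡ e) , ≤ᵇ-true⁻ (∧-true⁻ʳ {branch w start z} e)

    count-prefix : ∀ s → s ≤ d w u → count (leg-prefix w u s) ≡ s
    count-prefix zero _ = count-none _ empty
      where
      empty : ∀ z → leg-prefix w u 0 z ≡ false
      empty z with true⊎false (leg-prefix w u 0 z)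
      ... | inj₂ e = e
      ... | inj₁ e = let (hop , d≤0) = prefix⁻ e in ⊥-elim (<⇒≱ (proj₁ (branch-is-path z hop)) d≤0)
    count-prefix (suc s) s<d = begin
      count (leg-prefix w u (suc s))               ≡⟨ count-↔ grow shrink ⟩
      count (λ z → leg-prefix w u s z ∨ new z)     ≡⟨ count-∨-disjoint (leg-prefix w u s) new apart ⟩
      count (leg-prefix w u s) + count new         ≡⟨ cong₂ _+_ (count-prefix s (<⇒≤ s<d)) (count-≟ (geo w u (suc s))) ⟩
      s + 1                                ≡⟨ +-comm s 1 ⟩
      suc s                                ∎
      where
      open ≡-Reasoning
      new : Fin n → Bool
      new z = ⌊ z ≟ geo w u (suc s) ⌋
      level : d w (geo w u (suc s)) ≡ suc s
      level = d-geo w u (suc s) s<d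
      apart : ∀ z → leg-prefix w u s z ≡ true → new z ≡ true → ⊥
      apart z e₁ e₂ = <⇒≱ (s≤s ≤-refl) (subst (_≤ s) level (subst (λ t → d w t ≤ s) (⌊≟⌋-true⁻ e₂) (proj₂ (prefix⁻ e₁))))
      grow : ∀ z → leg-prefix w u (suc s) z ≡ true → (leg-prefix w u s z ∨ new z) ≡ true
      grow z e with prefix⁻ e | d w z ≤? s
      ... | hop , _ | yes d≤s = ∨-true⁺ˡ (prefix⁺ hop d≤s)
      ... | hop , d≤1+s | no d≰s = ∨-true⁺ʳ {leg-prefix w u s z} (subst (λ t → ⌊ z ≟ geo w u t ⌋ ≡ true) d≡1+s
                                       (subst (λ t → ⌊ t ≟ geo w u (d w z) ⌋ ≡ true) (sym (proj₂ (proj₂ (branch-is-path z hop)))) (⌊≟⌋-refl _)))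
        where
        d≡1+s : d w z ≡ suc s
        d≡1+s = ≤-antisym d≤1+s (≰⇒> d≰s)
      shrink : ∀ z → (leg-prefix w u s z ∨ new z) ≡ true → leg-prefix w u (suc s) z ≡ true
      shrink z e with ∨-true⁻ {leg-prefix w u s z} e
      ... | inj₁ e′ = let (hop , d≤s) = prefix⁻ e′ in prefix⁺ hop (m≤n⇒m≤1+n d≤s)
      ... | inj₂ e′ = subst (λ t → leg-prefix w u (suc s) t ≡ true) (sym (⌊≟⌋-true⁻ e′))
                        (prefix⁺ (next-hop-geo (suc s) (s≤s z≤n) s<d first-hop) (≤-reflexive level))

    count-leg∧ : ∀ (S : Fin n → Bool) → count (λ z → S z ∧ branch w start z) ≤ d w u
    count-leg∧ S = ≤-trans (count-mono (λ z e → prefix⁺ (in-leg (∧-true⁻ʳ {S z} e)) (proj₁ (proj₂ (branch-is-path z (in-leg (∧-true⁻ʳ {S z} e)))))))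
                     (≤-reflexive (count-prefix (d w u) ≤-refl))

  legs-disjoint : ∀ {w u w′ u′ z} → isTerminal G u w ≡ true → isTerminal G u′ w′ ≡ true →
    NextHop w z (geo w u 1) → NextHop w′ z (geo w′ u′ 1) → w ≡ w′ × u ≡ u′
  legs-disjoint {w} {u} {w′} {u′} {z} t t′ hop hop′ = w≡w′ , same-leg w≡w′ hop′
    where
    module L  = Leg w u t
    module L′ = Leg w′ u′ t′
    e₁ : d z w′ ≡ d z w + d w w′
    e₁ = d-behind hop (L.major∉leg (terminal⇒major t′))
    e₂ : d z w ≡ d z w′ + d w′ w
    e₂ = d-behind hop′ (L′.major∉leg (terminal⇒major t))
    w≡w′ : w ≡ w′
    w≡w′ = d≡0⇒≡ (m+n≡0⇒m≡0 (d w w′) (+-cancelˡ-≡ (d z w) _ 0 (begin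
      d z w + (d w w′ + d w′ w)  ≡⟨ +-assoc (d z w) _ _ ⟨
      d z w + d w w′ + d w′ w    ≡⟨ cong (_+ d w′ w) e₁ ⟨
      d z w′ + d w′ w            ≡⟨ e₂ ⟨
      d z w                      ≡⟨ +-identityʳ (d z w) ⟨
      d z w + 0                  ∎)))
      where open ≡-Reasoning
    same-leg : w ≡ w′ → NextHop w′ z (geo w′ u′ 1) → u ≡ u′
    same-leg refl hop″ = sym (trans (proj₂ (proj₂ u′-on-L)) (trans (cong (geo w u) same-d) (geo-end w u)))
      where
      starts≡ : geo w u 1 ≡ geo w u′ 1
      starts≡ = next-hop-unique hop hop″
      u′-on-L : 1 ≤ d w u′ × d w u′ ≤ d w u × u′ ≡ geo w u (d w u′)
      u′-on-L = L.branch-is-path u′ (subst (NextHop w u′) (sym starts≡) L′.first-hop)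
      u-on-L′ : 1 ≤ d w u × d w u ≤ d w u′ × u ≡ geo w u′ (d w u)
      u-on-L′ = L′.branch-is-path u (subst (NextHop w u) starts≡ L.first-hop)
      same-d : d w u′ ≡ d w u
      same-d = ≤-antisym (proj₁ (proj₂ u′-on-L)) (proj₁ (proj₂ u-on-L′))

  ter≡count : ∀ w → ter G w ≡ count (λ u → isTerminal G u w)
  ter≡count w = length-filter-allFin (λ u → isTerminal G u w)

  ∈terminals⁺ : ∀ {u w} → isTerminal G u w ≡ true → u ∈ terminals G w
  ∈terminals⁺ {u} {w} e = MemP.∈-filter⁺ (T? ∘ λ u → isTerminal G u w) (∈-allFin u) (≡true⇒T e)

  ∈terminals⁻ : ∀ {u w} → u ∈ terminals G w → isTerminal G u w ≡ true
  ∈terminals⁻ {u} {w} u∈ = T⇒≡true (proj₂ (MemP.∈-filter⁻ (T? ∘ λ u → isTerminal G u w) {xs = allFin n} u∈))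

  terminals-unique : ∀ w → Unique (terminals G w)
  terminals-unique w = UP.filter⁺ (T? ∘ λ u → isTerminal G u w) (UP.allFin⁺ n)

  𝓜? : Fin n → Bool
  𝓜? v = isMajor G v ∧ (1 <ᵇ ter G v)

  ∈𝓜⁺ : ∀ {w} → isMajor G w ≡ true → 2 ≤ ter G w → w ∈ 𝓜 G
  ∈𝓜⁺ {w} major 2≤ter = MemP.∈-filter⁺ (T? ∘ 𝓜?) (∈-allFin w) (≡true⇒T (∧-true⁺ major (<ᵇ-true⁺ 2≤ter)))

  ∈𝓜⁻ : ∀ {w} → w ∈ 𝓜 G → isMajor G w ≡ true × 2 ≤ ter G w
  ∈𝓜⁻ {w} w∈ = ∧-true⁻ˡ e , <ᵇ-true⁻ (∧-true⁻ʳ {isMajor G w} e)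
    where e = T⇒≡true (proj₂ (MemP.∈-filter⁻ (T? ∘ 𝓜?) {xs = allFin n} w∈))

  𝓜-unique : Unique (𝓜 G)
  𝓜-unique = UP.filter⁺ (T? ∘ 𝓜?) (UP.allFin⁺ n)

  2≤count-terminals : ∀ {w} → w ∈ 𝓜 G → 2 ≤ count (λ u → isTerminal G u w)
  2≤count-terminals {w} w∈ = subst (2 ≤_) (ter≡count w) (proj₂ (∈𝓜⁻ w∈))

  two-terminals : ∀ {w} → w ∈ 𝓜 G → Σ (Fin n) λ u₁ → Σ (Fin n) λ u₂ →
    isTerminal G u₁ w ≡ true × isTerminal G u₂ w ≡ true × u₁ ≢ u₂
  two-terminals {w} w∈ with ∃-∉ (λ u → isTerminal G u w) [] (≤-trans (s≤s z≤n) (2≤count-terminals w∈))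
  ... | u₁ , t₁ , _ with ∃-∉ (λ u → isTerminal G u w) (u₁ ∷ []) (2≤count-terminals w∈)
  ... | u₂ , t₂ , u₂∉ = u₁ , u₂ , t₁ , t₂ , λ { refl → u₂∉ (here refl) }

  -- Beyond the major vertex w of the branch farthest from m there is no major vertex, so every neighbour
  -- of w other than the one towards m starts a leg of w inside the branch.
  module FarthestMajor (m c : Fin n) (mc : Adj G m c) (z₀ : Fin n) (hop₀ : NextHop m z₀ c) (major₀ : isMajor G z₀ ≡ true) where
    farthest : Σ (Fin n) λ z → (isMajor G z ∧ branch m c z) ≡ true × (∀ z′ → (isMajor G z′ ∧ branch m c z′) ≡ true → d m z′ ≤ d m z)
    farthest = argmax (λ z → isMajor G z ∧ branch m c z) (d m) z₀ (∧-true⁺ major₀ (branch⁺ hop₀))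

    w : Fin n
    w = proj₁ farthest

    w-major : isMajor G w ≡ true
    w-major = ∧-true⁻ˡ (proj₁ (proj₂ farthest))

    w-in-branch : NextHop m w c
    w-in-branch = branch⁻ mc (∧-true⁻ʳ {isMajor G w} (proj₁ (proj₂ farthest)))

    w≢m : w ≢ m
    w≢m e = next-hop⇒≢ w-in-branch (sym e)

    back : Fin n
    back = proj₁ (next-hop w≢m)

    beyond : ∀ {q z} → NextHop w z q → back ≢ q → NextHop m z c × d m z ≡ d m w + d w z
    beyond {z = z} hop back≢q = next-hop-extend (sym through) w-in-branch , through
      where
      through : d m z ≡ d m w + d w z
      through = d-through (proj₂ (next-hop w≢m)) hop back≢q

    beyond-minor : ∀ {q} → back ≢ q → ∀ z → NextHop w z q → isMajor G z ≡ false
    beyond-minor back≢q z hop with true⊎false (isMajor G z)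
    ... | inj₂ minor = minor
    ... | inj₁ major = ⊥-elim (<⇒≱ (subst (d m w <_) (sym (proj₂ (beyond hop back≢q))) (m<m+n (d m w) (d-pos (next-hop⇒≢ hop))))
                                   (proj₂ (proj₂ farthest) z (∧-true⁺ major (branch⁺ (proj₁ (beyond hop back≢q))))))

    terminal-through : ∀ {q} → Adj G w q → back ≢ q → Σ (Fin n) λ u → isTerminal G u w ≡ true × geo w u 1 ≡ q
    terminal-through wq back≢q = B.leaf , B.leaf-terminal w-major , B.first-hop≡q
      where module B = MajorFreeBranch w _ wq (beyond-minor back≢q)

    back≢ : ∀ {q xs} → q ∉ back ∷ xs → back ≢ q
    back≢ q∉ refl = q∉ (here refl)

    in-branch : ∀ {u q z} → geo w u 1 ≡ q → back ≢ q → NextHop w z (geo w u 1) → NextHop m z c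
    in-branch refl back≢q hop = proj₁ (beyond hop back≢q)

    two-legs-in-branch : Σ (Fin n) λ u₁ → Σ (Fin n) λ u₂ → isTerminal G u₁ w ≡ true × isTerminal G u₂ w ≡ true × u₁ ≢ u₂ ×
      (∀ {z} → NextHop w z (geo w u₁ 1) → NextHop m z c) × (∀ {z} → NextHop w z (geo w u₂ 1) → NextHop m z c)
    two-legs-in-branch = u₁ , u₂ , t₁ , t₂ , u₁≢u₂ , in-branch start₁ (back≢ q₁∉) , in-branch start₂ (back≢ q₂∉)
      where
      other₁ : Σ (Fin n) λ q → Adj G w q × q ∉ back ∷ []
      other₁ = ∃-neighbour-∉ G (back ∷ []) (≤-trans (n≤1+n 2) (isMajor⁻ G w-major))
      q₁ : Fin n
      q₁ = proj₁ other₁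
      q₁∉ : q₁ ∉ back ∷ []
      q₁∉ = proj₂ (proj₂ other₁)
      other₂ : Σ (Fin n) λ q → Adj G w q × q ∉ back ∷ q₁ ∷ []
      other₂ = ∃-neighbour-∉ G (back ∷ q₁ ∷ []) (isMajor⁻ G w-major)
      q₂ : Fin n
      q₂ = proj₁ other₂
      q₂∉ : q₂ ∉ back ∷ q₁ ∷ []
      q₂∉ = proj₂ (proj₂ other₂)
      leg₁ : Σ (Fin n) λ u → isTerminal G u w ≡ true × geo w u 1 ≡ q₁
      leg₁ = terminal-through (proj₁ (proj₂ other₁)) (back≢ q₁∉)
      leg₂ : Σ (Fin n) λ u → isTerminal G u w ≡ true × geo w u 1 ≡ q₂
      leg₂ = terminal-through (proj₁ (proj₂ other₂)) (back≢ q₂∉)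
      u₁ u₂ : Fin n
      u₁ = proj₁ leg₁
      u₂ = proj₁ leg₂
      t₁ : isTerminal G u₁ w ≡ true
      t₁ = proj₁ (proj₂ leg₁)
      t₂ : isTerminal G u₂ w ≡ true
      t₂ = proj₁ (proj₂ leg₂)
      start₁ : geo w u₁ 1 ≡ q₁
      start₁ = proj₂ (proj₂ leg₁)
      start₂ : geo w u₂ 1 ≡ q₂
      start₂ = proj₂ (proj₂ leg₂)
      u₁≢u₂ : u₁ ≢ u₂
      u₁≢u₂ u₁≡u₂ = q₂∉ (there (here (trans (sym start₂) (trans (cong (λ u → geo w u 1) (sym u₁≡u₂)) start₁))))

    w∈𝓜 : w ∈ 𝓜 G
    w∈𝓜 = let (_ , _ , t₁ , t₂ , u₁≢u₂ , _) = two-legs-in-branch in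
          ∈𝓜⁺ w-major (subst (2 ≤_) (sym (ter≡count w)) (count≥2 (λ u → isTerminal G u w) t₁ t₂ u₁≢u₂))

  nearest-in : Fin n → List (Fin n) → Fin n
  nearest-in w []       = w
  nearest-in w (u ∷ us) = argmin (λ u → d u w) u us

  nearest : Fin n → Fin n
  nearest w = nearest-in w (terminals G w)

  nearest-terminal : ∀ {w} → w ∈ 𝓜 G → isTerminal G (nearest w) w ≡ true × d (nearest w) w ≡ l G w
  nearest-terminal {w} w∈ = let (∈us , d≡min) = facts (terminals G w) (≤-trans (s≤s z≤n) 2≤ter) in ∈terminals⁻ ∈us , d≡min
    where
    2≤ter : 2 ≤ length (terminals G w)
    2≤ter = proj₂ (∈𝓜⁻ w∈)
    facts : ∀ us → 1 ≤ length us → nearest-in w us ∈ us × d (nearest-in w us) w ≡ minList (map (λ u → d u w) us)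
    facts (u ∷ us) _ = argmin-∈ (λ u → d u w) u us , argmin-minList (λ u → d u w) u us

  l≤d : ∀ {w u} → isTerminal G u w ≡ true → l G w ≤ d u w
  l≤d {w} {u} t = minList-≤ (MemP.∈-map⁺ (λ u → dist G u w) (∈terminals⁺ t))

  ςv≤ : ∀ {w u₁ u₂} → isTerminal G u₁ w ≡ true → isTerminal G u₂ w ≡ true → u₁ ≢ u₂ → ςv G w ≤ d u₁ w + d w u₂
  ςv≤ {w} {u₁} {u₂} t₁ t₂ u₁≢u₂ = minList-≤ (MemP.∈-concatMap⁺ (λ uj → map (ςpair G w uj) (filterᵇ (λ ur → not ⌊ uj ≟ ur ⌋) (terminals G w)))
                                  (Any.map (λ { refl → pair∈ }) (∈terminals⁺ t₁)))
    where
    pair∈ : ςpair G w u₁ u₂ ∈ map (ςpair G w u₁) (filterᵇ (λ ur → not ⌊ u₁ ≟ ur ⌋) (terminals G w))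
    pair∈ = MemP.∈-map⁺ (ςpair G w u₁) (MemP.∈-filter⁺ (T? ∘ λ ur → not ⌊ u₁ ≟ ur ⌋) (∈terminals⁺ t₂) (≡true⇒T (not-true⁺ (⌊≟⌋-false⁺ u₁≢u₂))))

  ςG≤ςv : ∀ {w} → w ∈ 𝓜 G → ςG G ≤ ςv G w
  ςG≤ςv w∈ = minList-≤ (MemP.∈-map⁺ (ςv G) w∈)

  nearer-in-branch : ∀ {m x y p q z} → NextHop m x p → NextHop m y q → p ≢ q → d x m ≡ d y m → NextHop m z p → d x z < d y z
  nearer-in-branch {m} {x} {y} {p} {q} {z} (mp , ex) hop-y p≢q dx≡dy (_ , ez) = begin-strict
    d x z                      ≤⟨ d-triangle x p z ⟩
    d x p + d p z              <⟨ +-mono-< (n<1+n _) (n<1+n _) ⟩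
    suc (d x p) + suc (d p z)  ≡⟨ cong₂ _+_ (trans (cong suc (d-sym x p)) (trans ex (d-sym m x))) ez ⟩
    d x m + d m z              ≡⟨ cong (_+ d m z) dx≡dy ⟩
    d y m + d m z              ≡⟨ d-through hop-y (mp , ez) (p≢q ∘ sym) ⟨
    d y z                      ∎
    where open ≤-Reasoning

  module Generator (r : ℕ) (r≤ς : r ≤ ςG G) where
    near-quota : Fin n → ℕ
    near-quota w = if l G w ≤ᵇ r / 2 then l G w else r / 2

    near-quota-cases : ∀ w → (l G w ≤ r / 2 × near-quota w ≡ l G w) ⊎ (r / 2 < l G w × near-quota w ≡ r / 2)
    near-quota-cases w with true⊎false (l G w ≤ᵇ r / 2)
    ... | inj₁ e = inj₁ (≤ᵇ-true⁻ e , if-true e)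
    ... | inj₂ e = inj₂ (≤ᵇ-false⁻ e , if-false e)

    near-quota≤r/2 : ∀ w → near-quota w ≤ r / 2
    near-quota≤r/2 w = [ (λ (l≤ , e) → subst (_≤ r / 2) (sym e) l≤) , (λ (_ , e) → ≤-reflexive e) ]′ (near-quota-cases w)

    near-quota≤l : ∀ w → near-quota w ≤ l G w
    near-quota≤l w = [ (λ (_ , e) → ≤-reflexive e) , (λ (<l , e) → subst (_≤ l G w) (sym e) (<⇒≤ <l)) ]′ (near-quota-cases w)

    near-quota≤r : ∀ w → near-quota w ≤ r
    near-quota≤r w = ≤-trans (near-quota≤r/2 w) (m/n≤m r 2)

    I≡ : ∀ w → I G r w ≡ near-quota w + (ter G w ∸ 1) * (r ∸ near-quota w)
    I≡ w with true⊎false (l G w ≤ᵇ r / 2)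
    ... | inj₁ e = trans (if-true e) (trans (+-comm _ (l G w))
                     (sym (cong₂ (λ s t → s + (ter G w ∸ 1) * (r ∸ t)) (if-true e) (if-true e))))
    ... | inj₂ e = trans (if-false e) (trans (+-comm _ (r / 2))
                     (sym (cong₂ (λ s t → s + (ter G w ∸ 1) * t) (if-false e) (trans (cong (r ∸_) (if-false e)) (sym ([r+1]/2≡r∸r/2 r))))))

    quota : Fin n → Fin n → ℕ
    quota w u = if ⌊ u ≟ nearest w ⌋ then near-quota w else r ∸ near-quota w

    quota-nearest : ∀ w {u} → u ≡ nearest w → quota w u ≡ near-quota w
    quota-nearest w refl = if-true (⌊≟⌋-refl (nearest w))

    quota-other : ∀ w {u} → u ≢ nearest w → quota w u ≡ r ∸ near-quota w
    quota-other w u≢ = if-false (⌊≟⌋-false⁺ u≢)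

    quota-pair : ∀ w {u₁ u₂} → u₁ ≢ u₂ → r ≤ quota w u₁ + quota w u₂
    quota-pair w {u₁} {u₂} u₁≢u₂ = by-cases (u₁ ≟ nearest w) (u₂ ≟ nearest w)
      where
      by-cases : Dec (u₁ ≡ nearest w) → Dec (u₂ ≡ nearest w) → r ≤ quota w u₁ + quota w u₂
      by-cases (yes e₁) (yes e₂) = ⊥-elim (u₁≢u₂ (trans e₁ (sym e₂)))
      by-cases (yes e₁) (no n₂)  = ≤-reflexive (sym (trans (cong₂ _+_ (quota-nearest w e₁) (quota-other w n₂)) (m+[n∸m]≡n (near-quota≤r w))))
      by-cases (no n₁)  (yes e₂) = ≤-reflexive (sym (trans (cong₂ _+_ (quota-other w n₁) (quota-nearest w e₂)) (m∸n+n≡m (near-quota≤r w))))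
      by-cases (no n₁)  (no n₂)  = subst (r ≤_) (sym (cong₂ _+_ (quota-other w n₁) (quota-other w n₂))) (begin
        r                                        ≡⟨ m+[n∸m]≡n (m/n≤m r 2) ⟨
        r / 2 + (r ∸ r / 2)                      ≤⟨ +-monoˡ-≤ _ (r/2≤r∸r/2 r) ⟩
        (r ∸ r / 2) + (r ∸ r / 2)                ≤⟨ +-mono-≤ (∸-monoʳ-≤ r (near-quota≤r/2 w)) (∸-monoʳ-≤ r (near-quota≤r/2 w)) ⟩
        (r ∸ near-quota w) + (r ∸ near-quota w)  ∎)
        where open ≤-Reasoning

    r≤ςpair : ∀ {w u₁ u₂} → w ∈ 𝓜 G → isTerminal G u₁ w ≡ true → isTerminal G u₂ w ≡ true → u₁ ≢ u₂ → r ≤ d u₁ w + d w u₂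
    r≤ςpair w∈ t₁ t₂ u₁≢u₂ = ≤-trans r≤ς (≤-trans (ςG≤ςv w∈) (ςv≤ t₁ t₂ u₁≢u₂))

    quota≤leg : ∀ {w u} → w ∈ 𝓜 G → isTerminal G u w ≡ true → quota w u ≤ d w u
    quota≤leg {w} {u} w∈ t = by-cases (u ≟ nearest w)
      where
      t₀ : isTerminal G (nearest w) w ≡ true
      t₀ = proj₁ (nearest-terminal w∈)
      d≡l : d (nearest w) w ≡ l G w
      d≡l = proj₂ (nearest-terminal w∈)
      by-cases : Dec (u ≡ nearest w) → quota w u ≤ d w u
      by-cases (yes u≡) = subst (_≤ d w u) (sym (quota-nearest w u≡))
        (≤-trans (near-quota≤l w) (≤-reflexive (trans (sym d≡l) (trans (cong (λ t → d t w) (sym u≡)) (d-sym u w)))))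
      by-cases (no u≢) = subst (_≤ d w u) (sym (quota-other w u≢)) ([ via-ς , via-half ]′ (near-quota-cases w))
        where
        via-ς : l G w ≤ r / 2 × near-quota w ≡ l G w → r ∸ near-quota w ≤ d w u
        via-ς (_ , e) = subst (λ t → r ∸ t ≤ d w u) (sym (trans e (sym d≡l)))
          (m≤n+o⇒m∸n≤o r (d (nearest w) w) (r≤ςpair w∈ t₀ t (u≢ ∘ sym)))
        via-half : r / 2 < l G w × near-quota w ≡ r / 2 → r ∸ near-quota w ≤ d w u
        via-half (r/2<l , e) = subst (λ t → r ∸ t ≤ d w u) (sym e)
          (≤-trans (r∸r/2≤1+r/2 r) (≤-trans r/2<l (subst (l G w ≤_) (d-sym u w) (l≤d t))))

    S-at : Fin n → Fin n → Bool
    S-at w = anyOf (terminals G w) (λ u → leg-prefix w u (quota w u))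

    S : Fin n → Bool
    S = anyOf (𝓜 G) S-at

    prefix⊆S : ∀ {w u z} → w ∈ 𝓜 G → isTerminal G u w ≡ true → leg-prefix w u (quota w u) z ≡ true → S z ≡ true
    prefix⊆S w∈ t e = anyOf⁺ (𝓜 G) S-at w∈ (anyOf⁺ (terminals G _) _ (∈terminals⁺ t) e)

    prefix-in-leg : ∀ {w u s z} → isTerminal G u w ≡ true → leg-prefix w u s z ≡ true → NextHop w z (geo w u 1)
    prefix-in-leg {w} {u} t e = proj₁ (Leg.prefix⁻ w u t e)

    count-quota : ∀ {w u} → w ∈ 𝓜 G → isTerminal G u w ≡ true → count (leg-prefix w u (quota w u)) ≡ quota w u
    count-quota {w} {u} w∈ t = Leg.count-prefix w u t (quota w u) (quota≤leg w∈ t)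

    count-S-at : ∀ {w} → w ∈ 𝓜 G → count (S-at w) ≡ I G r w
    count-S-at {w} w∈ = begin
      count (S-at w)                                               ≡⟨ count-anyOf-disjoint (terminals G w) (λ u → leg-prefix w u (quota w u)) (terminals-unique w) apart ⟩
      sum (map (λ u → count (leg-prefix w u (quota w u))) (terminals G w))  ≡⟨ sum-map-cong (terminals G w) (λ u∈ → count-quota w∈ (∈terminals⁻ u∈)) ⟩
      sum (map (quota w) (terminals G w))                          ≡⟨ sum-map-if-≟ (terminals G w) _ _ (terminals-unique w) (∈terminals⁺ (proj₁ (nearest-terminal w∈))) ⟩
      near-quota w + (ter G w ∸ 1) * (r ∸ near-quota w)            ≡⟨ I≡ w ⟨
      I G r w                                                      ∎
      where
      open ≡-Reasoning
      apart : ∀ {u u′ z} → u ∈ terminals G w → u′ ∈ terminals G w → u ≢ u′ →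
        leg-prefix w u (quota w u) z ≡ true → leg-prefix w u′ (quota w u′) z ≡ true → ⊥
      apart u∈ u′∈ u≢u′ e e′ = u≢u′ (proj₂ (legs-disjoint (∈terminals⁻ u∈) (∈terminals⁻ u′∈)
                                                (prefix-in-leg (∈terminals⁻ u∈) e) (prefix-in-leg (∈terminals⁻ u′∈) e′)))

    S-at⁻ : ∀ {w z} → S-at w z ≡ true → Σ (Fin n) λ u → isTerminal G u w ≡ true × NextHop w z (geo w u 1)
    S-at⁻ e with anyOf⁻ (terminals G _) _ e
    ... | u , u∈ , e′ = u , ∈terminals⁻ u∈ , prefix-in-leg (∈terminals⁻ u∈) e′

    count-S : count S ≡ sum (map (I G r) (𝓜 G))
    count-S = trans (count-anyOf-disjoint (𝓜 G) S-at 𝓜-unique apart) (sum-map-cong (𝓜 G) count-S-at)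
      where
      apart : ∀ {w w′ z} → w ∈ 𝓜 G → w′ ∈ 𝓜 G → w ≢ w′ → S-at w z ≡ true → S-at w′ z ≡ true → ⊥
      apart _ _ w≢w′ e e′ with S-at⁻ e | S-at⁻ e′
      ... | _ , t , hop | _ , t′ , hop′ = w≢w′ (proj₁ (legs-disjoint t t′ hop hop′))

    legs-resolve : ∀ {w u₁ u₂} → w ∈ 𝓜 G → isTerminal G u₁ w ≡ true → isTerminal G u₂ w ≡ true → u₁ ≢ u₂ →
      (Q : Fin n → Bool) → (∀ {z} → S z ≡ true → NextHop w z (geo w u₁ 1) → Q z ≡ true) →
      (∀ {z} → S z ≡ true → NextHop w z (geo w u₂ 1) → Q z ≡ true) → r ≤ count Q
    legs-resolve {w} {u₁} {u₂} w∈ t₁ t₂ u₁≢u₂ Q in₁ in₂ = begin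
      r                                   ≤⟨ quota-pair w u₁≢u₂ ⟩
      quota w u₁ + quota w u₂             ≡⟨ cong₂ _+_ (count-quota w∈ t₁) (count-quota w∈ t₂) ⟨
      count P₁ + count P₂                 ≡⟨ count-∨-disjoint P₁ P₂ apart ⟨
      count (λ z → P₁ z ∨ P₂ z)           ≤⟨ count-mono {p = λ z → P₁ z ∨ P₂ z} (λ z e → [ in₁′ , in₂′ ]′ (∨-true⁻ {P₁ z} e)) ⟩
      count Q                             ∎
      where
      open ≤-Reasoning
      P₁ P₂ : Fin n → Bool
      P₁ = leg-prefix w u₁ (quota w u₁)
      P₂ = leg-prefix w u₂ (quota w u₂)
      apart : ∀ z → P₁ z ≡ true → P₂ z ≡ true → ⊥
      apart z e₁ e₂ = u₁≢u₂ (proj₂ (legs-disjoint t₁ t₂ (prefix-in-leg t₁ e₁) (prefix-in-leg t₂ e₂)))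
      in₁′ : ∀ {z} → P₁ z ≡ true → Q z ≡ true
      in₁′ e = in₁ (prefix⊆S w∈ t₁ e) (prefix-in-leg t₁ e)
      in₂′ : ∀ {z} → P₂ z ≡ true → Q z ≡ true
      in₂′ e = in₂ (prefix⊆S w∈ t₂ e) (prefix-in-leg t₂ e)

    branch-resolves : ∀ {m c z₀} → Adj G m c → NextHop m z₀ c → isMajor G z₀ ≡ true → r ≤ count (λ z → S z ∧ branch m c z)
    branch-resolves {m} {c} {z₀} mc hop₀ major₀ =
      let (u₁ , u₂ , t₁ , t₂ , u₁≢u₂ , in₁ , in₂) = F.two-legs-in-branch in
      legs-resolve F.w∈𝓜 t₁ t₂ u₁≢u₂ (λ z → S z ∧ branch m c z)
        (λ s hop → ∧-true⁺ s (branch⁺ (in₁ hop))) (λ s hop → ∧-true⁺ s (branch⁺ (in₂ hop)))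
      where module F = FarthestMajor m c mc z₀ hop₀ major₀

    module Resolve {w₀ : Fin n} (w₀∈ : w₀ ∈ 𝓜 G) (x y : Fin n) (x≢y : x ≢ y) where
      Q : Fin n → Bool
      Q z = S z ∧ not (d x z ≡ᵇ d y z)

      Q⁺ : ∀ {z} → S z ≡ true → d x z ≢ d y z → Q z ≡ true
      Q⁺ s differ = ∧-true⁺ s (not-true⁺ (≡ᵇ-false⁺ differ))

      all-legs-resolve : (∀ z → d x z ≢ d y z) → r ≤ count Q
      all-legs-resolve differ with two-terminals w₀∈
      ... | u₁ , u₂ , t₁ , t₂ , u₁≢u₂ = legs-resolve w₀∈ t₁ t₂ u₁≢u₂ Q (λ s _ → Q⁺ s (differ _)) (λ s _ → Q⁺ s (differ _))

      module Midpoint (h : ℕ) (d≡ : d x y ≡ suc h + suc h) where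
        mid a b : Fin n
        mid = geo x y (suc h)
        a = geo x y h
        b = geo x y (suc (suc h))

        1+h≤d : suc h ≤ d x y
        1+h≤d = subst (suc h ≤_) (sym d≡) (m≤m+n (suc h) (suc h))
        2+h≤d : suc (suc h) ≤ d x y
        2+h≤d = subst (suc (suc h) ≤_) (sym (trans d≡ (cong suc (+-suc h h)))) (m≤m+n (suc (suc h)) h)

        dx-mid : d x mid ≡ suc h
        dx-mid = d-geo x y (suc h) 1+h≤d
        dmid-y : d mid y ≡ suc h
        dmid-y = trans (d-geo-end x y (suc h) 1+h≤d) (trans (cong (_∸ suc h) d≡) (m+n∸m≡n (suc h) (suc h)))

        toward-x : NextHop mid x a
        toward-x = Adj-sym G (geo-adj x y h 1+h≤d) ,
                   trans (cong suc (trans (d-sym a x) (d-geo x y h (<⇒≤ 1+h≤d)))) (sym (trans (d-sym mid x) dx-mid))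
        toward-y : NextHop mid y b
        toward-y = geo-adj x y (suc h) 2+h≤d ,
                   trans (cong suc (trans (d-geo-end x y (suc (suc h)) 2+h≤d) (trans (cong (_∸ suc (suc h)) (trans d≡ (cong suc (+-suc h h))))
                     (m+n∸m≡n (suc (suc h)) h)))) (sym dmid-y)

        a≢b : a ≢ b
        a≢b e = m+1+n≢n 1 (sym (geo-injective x y h (suc (suc h)) (<⇒≤ 1+h≤d) 2+h≤d e))

        equidistant : d x mid ≡ d y mid
        equidistant = trans dx-mid (sym (trans (d-sym y mid) dmid-y))

        side-a : ∀ {z} → NextHop mid z a → d x z ≢ d y z
        side-a hop = <⇒≢ (nearer-in-branch toward-x toward-y a≢b equidistant hop)
        side-b : ∀ {z} → NextHop mid z b → d x z ≢ d y z
        side-b hop = ≢-sym (<⇒≢ (nearer-in-branch toward-y toward-x (a≢b ∘ sym) (sym equidistant) hop))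

        HasMajor : Fin n → Set
        HasMajor c = Σ (Fin n) λ z → (branch mid c z ∧ isMajor G z) ≡ true

        has-major? : ∀ c → Dec (HasMajor c)
        has-major? c = FinP.any? (λ z → (branch mid c z ∧ isMajor G z) BoolP.≟ true)

        via-branch : ∀ {c} → Adj G mid c → (∀ {z} → NextHop mid z c → d x z ≢ d y z) → HasMajor c → r ≤ count Q
        via-branch {c} mid-c side (z₁ , e) = ≤-trans (branch-resolves mid-c (branch⁻ mid-c (∧-true⁻ˡ e)) (∧-true⁻ʳ {branch mid c z₁} e))
          (count-mono (λ z e′ → Q⁺ (∧-true⁻ˡ e′) (side (branch⁻ mid-c (∧-true⁻ʳ {S z} e′)))))

        minor-branch : ∀ {c} → ¬ HasMajor c → ∀ z → NextHop mid z c → isMajor G z ≡ false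
        minor-branch ∄ z hop with true⊎false (isMajor G z)
        ... | inj₁ major = ⊥-elim (∄ (z , ∧-true⁺ (branch⁺ hop) major))
        ... | inj₂ minor = minor

        -- with no major vertex on either side, mid is major (w₀ must lie somewhere) and x, y are told
        -- apart by the legs of mid through a and b
        via-mid : ¬ HasMajor a → ¬ HasMajor b → r ≤ count Q
        via-mid ∄a ∄b with true⊎false (isMajor G mid)
        ... | inj₂ mid-minor = ⊥-elim (true≢false (proj₁ (∈𝓜⁻ w₀∈)) ([ minor-branch ∄a w₀ ∘ on , minor-branch ∄b w₀ ∘ on ]′
              (degree≤2-neighbour G (¬isMajor⁻ G mid-minor) (proj₁ toward-x) (proj₁ toward-y) a≢b (proj₁ (proj₂ toward-w₀)))))
          where
          w₀≢mid : w₀ ≢ mid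
          w₀≢mid e = true≢false (proj₁ (∈𝓜⁻ w₀∈)) (subst (λ t → isMajor G t ≡ false) (sym e) mid-minor)
          toward-w₀ : Σ (Fin n) (NextHop mid w₀)
          toward-w₀ = next-hop (w₀≢mid ∘ sym)
          on : ∀ {c} → proj₁ toward-w₀ ≡ c → NextHop mid w₀ c
          on refl = proj₂ toward-w₀
        ... | inj₁ mid-major = legs-resolve mid∈𝓜 (A.leaf-terminal mid-major) (B.leaf-terminal mid-major) leafA≢leafB Q
              (λ s hop → Q⁺ s (side-a (subst (NextHop mid _) A.first-hop≡q hop)))
              (λ s hop → Q⁺ s (side-b (subst (NextHop mid _) B.first-hop≡q hop)))
          where
          module A = MajorFreeBranch mid a (proj₁ toward-x) (minor-branch ∄a)
          module B = MajorFreeBranch mid b (proj₁ toward-y) (minor-branch ∄b)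
          leafA≢leafB : A.leaf ≢ B.leaf
          leafA≢leafB e = a≢b (trans (sym A.first-hop≡q) (trans (cong (λ u → geo mid u 1) e) B.first-hop≡q))
          mid∈𝓜 : mid ∈ 𝓜 G
          mid∈𝓜 = ∈𝓜⁺ mid-major (subst (2 ≤_) (sym (ter≡count mid))
                    (count≥2 (λ u → isTerminal G u mid) (A.leaf-terminal mid-major) (B.leaf-terminal mid-major) leafA≢leafB))

        resolved : r ≤ count Q
        resolved with has-major? a | has-major? b
        ... | yes ∃a | _      = via-branch (proj₁ toward-x) side-a ∃a
        ... | no _   | yes ∃b = via-branch (proj₁ toward-y) side-b ∃b
        ... | no ∄a  | no ∄b  = via-mid ∄a ∄b

      resolved : r ≤ count Q
      resolved with true⊎false (odd (d x y))
      ... | inj₁ odd-d = all-legs-resolve (λ z e → true≢false odd-d (equidistant⇒even x y z e))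
      ... | inj₂ even-d with even⇒double (d x y) even-d
      ...   | zero  , d≡0 = ⊥-elim (x≢y (d≡0⇒≡ d≡0))
      ...   | suc h , d≡  = Midpoint.resolved h d≡

    module Lower (S′ : Fin n → Bool) (generates : ∀ x y → x ≢ y → r ≤ count (λ z → S′ z ∧ not (d x z ≡ᵇ d y z))) where
      on-leg : Fin n → Fin n → ℕ
      on-leg w u = count (λ z → S′ z ∧ leg w u z)

      pair-bound : ∀ {w u₁ u₂} → u₁ ∈ terminals G w → u₂ ∈ terminals G w → u₁ ≢ u₂ →
        near-quota w + (r ∸ near-quota w) ≤ on-leg w u₁ + on-leg w u₂
      pair-bound {w} {u₁} {u₂} u₁∈ u₂∈ u₁≢u₂ = subst (_≤ on-leg w u₁ + on-leg w u₂) (sym (m+[n∸m]≡n (near-quota≤r w))) (begin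
        r                                          ≤⟨ generates x y x≢y ⟩
        count (λ z → S′ z ∧ not (d x z ≡ᵇ d y z))  ≤⟨ count-mono on-a-leg ⟩
        count (λ z → (S′ z ∧ leg w u₁ z) ∨ (S′ z ∧ leg w u₂ z)) ≤⟨ count-∨ (λ z → S′ z ∧ leg w u₁ z) (λ z → S′ z ∧ leg w u₂ z) ⟩
        on-leg w u₁ + on-leg w u₂                  ∎)
        where
        open ≤-Reasoning
        t₁ : isTerminal G u₁ w ≡ true
        t₁ = ∈terminals⁻ u₁∈
        t₂ : isTerminal G u₂ w ≡ true
        t₂ = ∈terminals⁻ u₂∈
        module L₁ = Leg w u₁ t₁
        module L₂ = Leg w u₂ t₂
        x y : Fin n
        x = L₁.start
        y = L₂.start
        x≢y : x ≢ y
        x≢y e = u₁≢u₂ (proj₂ (legs-disjoint t₁ t₂ (next-hop-adj L₁.w-start) (subst (λ t → NextHop w t y) (sym e) (next-hop-adj L₂.w-start))))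
        on-a-leg : ∀ z → (S′ z ∧ not (d x z ≡ᵇ d y z)) ≡ true → ((S′ z ∧ leg w u₁ z) ∨ (S′ z ∧ leg w u₂ z)) ≡ true
        on-a-leg z e with true⊎false (leg w u₁ z) | true⊎false (leg w u₂ z)
        ... | inj₁ e₁ | _       = ∨-true⁺ˡ (∧-true⁺ (∧-true⁻ˡ {S′ z} e) e₁)
        ... | inj₂ _  | inj₁ e₂ = ∨-true⁺ʳ {S′ z ∧ leg w u₁ z} (∧-true⁺ (∧-true⁻ˡ {S′ z} e) e₂)
        ... | inj₂ f₁ | inj₂ f₂ = ⊥-elim (true≢false (≡ᵇ-true⁺ same) (not-true⁻ (∧-true⁻ʳ {S′ z} e)))
          where
          same : d x z ≡ d y z
          same = trans (d-behind (next-hop-adj L₁.w-start) (λ hop → true≢false (branch⁺ hop) f₁))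
                   (trans (cong (_+ d w z) (trans (d-adj (Adj-sym G L₁.w-start)) (sym (d-adj (Adj-sym G L₂.w-start)))))
                     (sym (d-behind (next-hop-adj L₂.w-start) (λ hop → true≢false (branch⁺ hop) f₂))))

      per-vertex : ∀ {w} → w ∈ 𝓜 G → I G r w ≤ sum (map (on-leg w) (terminals G w))
      per-vertex {w} w∈ = subst (_≤ sum (map (on-leg w) (terminals G w))) (sym (I≡ w))
        (sum-map-≥-pairwise (terminals G w) (on-leg w) (near-quota w) (r ∸ near-quota w) (l G w) (terminals-unique w)
          (∈terminals⁺ t₀) (proj₂ (∈𝓜⁻ w∈)) pair-bound near≤far on-nearest-leg cases)
        where
        t₀ : isTerminal G (nearest w) w ≡ true
        t₀ = proj₁ (nearest-terminal w∈)
        near≤far : near-quota w ≤ r ∸ near-quota w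
        near≤far = ≤-trans (near-quota≤r/2 w) (≤-trans (r/2≤r∸r/2 r) (∸-monoʳ-≤ r (near-quota≤r/2 w)))
        on-nearest-leg : on-leg w (nearest w) ≤ l G w
        on-nearest-leg = ≤-trans (Leg.count-leg∧ w (nearest w) t₀ S′)
                           (≤-reflexive (trans (d-sym w (nearest w)) (proj₂ (nearest-terminal w∈))))
        cases : near-quota w ≡ l G w ⊎ r ∸ near-quota w ≤ suc (near-quota w)
        cases = [ (λ (_ , e) → inj₁ e) , (λ (_ , e) → inj₂ (subst (λ t → r ∸ t ≤ suc t) (sym e) (r∸r/2≤1+r/2 r))) ]′ (near-quota-cases w)

      lower : sum (map (I G r) (𝓜 G)) ≤ count S′
      lower = begin
        sum (map (I G r) (𝓜 G))                                      ≤⟨ sum-map-mono (𝓜 G) per-vertex ⟩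
        sum (map (λ w → sum (map (on-leg w) (terminals G w))) (𝓜 G)) ≡⟨ sum-map-cong (𝓜 G) (λ {w} _ → sym (count-anyOf-disjoint (terminals G w) (λ u z → S′ z ∧ leg w u z) (terminals-unique w) legs-apart)) ⟩
        sum (map (count ∘ on-legs) (𝓜 G))                            ≡⟨ count-anyOf-disjoint (𝓜 G) on-legs 𝓜-unique vertices-apart ⟨
        count (anyOf (𝓜 G) on-legs)                                  ≤⟨ count-mono on-legs⊆S′ ⟩
        count S′                                                     ∎
        where
        open ≤-Reasoning
        on-legs : Fin n → Fin n → Bool
        on-legs w = anyOf (terminals G w) (λ u z → S′ z ∧ leg w u z)
        on-legs⊆S′ : ∀ z → anyOf (𝓜 G) on-legs z ≡ true → S′ z ≡ true
        on-legs⊆S′ z e with anyOf⁻ (𝓜 G) on-legs e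
        ... | w , _ , e′ with anyOf⁻ (terminals G w) (λ u z → S′ z ∧ leg w u z) e′
        ...   | _ , _ , e″ = ∧-true⁻ˡ e″
        in-leg : ∀ {w u z} → u ∈ terminals G w → (S′ z ∧ leg w u z) ≡ true → NextHop w z (geo w u 1)
        in-leg {z = z} u∈ e = Leg.in-leg _ _ (∈terminals⁻ u∈) (∧-true⁻ʳ {S′ z} e)
        legs-apart : ∀ {w u u′ z} → u ∈ terminals G w → u′ ∈ terminals G w → u ≢ u′ →
          (S′ z ∧ leg w u z) ≡ true → (S′ z ∧ leg w u′ z) ≡ true → ⊥
        legs-apart u∈ u′∈ u≢u′ e e′ = u≢u′ (proj₂ (legs-disjoint (∈terminals⁻ u∈) (∈terminals⁻ u′∈) (in-leg u∈ e) (in-leg u′∈ e′)))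
        vertices-apart : ∀ {w w′ z} → w ∈ 𝓜 G → w′ ∈ 𝓜 G → w ≢ w′ → on-legs w z ≡ true → on-legs w′ z ≡ true → ⊥
        vertices-apart {w} {w′} _ _ w≢w′ e e′ with anyOf⁻ (terminals G w) _ e | anyOf⁻ (terminals G w′) _ e′
        ... | _ , u∈ , e₁ | _ , u′∈ , e₂ = w≢w′ (proj₁ (legs-disjoint (∈terminals⁻ u∈) (∈terminals⁻ u′∈) (in-leg u∈ e₁) (in-leg u′∈ e₂)))

resolving≡count : ∀ {n} (G : Graph n) S x y → resolving G S x y ≡ count (λ z → ⌊ z ∈? S ⌋ ∧ not (dist G x z ≡ᵇ dist G y z))
resolving≡count G S x y = length-filter-allFin (λ z → ⌊ z ∈? S ⌋ ∧ not (dist G x z ≡ᵇ dist G y z))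

theorem26 : ∀ {n} (T : Graph n) → IsTree T → ¬ IsPathGraph T →
    ∀ (r : ℕ) → 1 ≤ r → r ≤ ςG T →
    IsDimR r T (sum (map (I T r) (𝓜 T)))
theorem26 {n} T (conn , acyc) _ r 1≤r r≤ς = (Data.Vec.tabulate S , generates , size) , minimal
  where
  open Tree T conn acyc
  open Generator r r≤ς

  generates : IsRMetricGenerator r T (Data.Vec.tabulate S)
  generates x y x≢y = subst (r ≤_) (sym (trans (resolving≡count T _ x y) (count-cong (λ z → cong (_∧ _) (∈?-tabulate S z)))))
    (Resolve.resolved (proj₂ (nonempty (𝓜 T) 1≤r r≤ς)) x y x≢y)

  size : ∣ Data.Vec.tabulate S ∣ ≡ sum (map (I T r) (𝓜 T))
  size = trans (∣∣≡count-∈? (Data.Vec.tabulate S)) (trans (count-cong (∈?-tabulate S)) count-S)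

  minimal : ∀ S′ → IsRMetricGenerator r T S′ → sum (map (I T r) (𝓜 T)) ≤ ∣ S′ ∣
  minimal S′ generates′ = subst (_ ≤_) (sym (∣∣≡count-∈? S′))
    (Lower.lower (λ z → ⌊ z ∈? S′ ⌋) (λ x y x≢y → subst (r ≤_) (resolving≡count T S′ x y) (generates′ x y x≢y)))
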